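{- Let $G$ be a nontrivial (i.e. having at least two vertices) connected triangle-free graph. Then $k(G)=\dim \mathcal{H}(G)+1$.
   Context: All graphs are finite, simple and undirected. The competition graph $C(D)$ of an acyclic digraph $D$ is the graph with vertex set $V(D)$ having an edge between distinct $x,y$ iff there is a vertex $v$ with $(x,v),(y,v)\in A(D)$. The competition number $k(G)$ of a graph $G$ is the smallest $k\ge 0$ such that $G$ together with $k$ new isolated vertices is the competition graph of some acyclic digraph. A hole of $G$ is an induced subgraph of $G$ which is a cycle of length at least $4$. For a cycle $C$ of $G$, $\chi_C:E(G)\to\mathbb{F}_2$ is the indicator map of $E(C)$ ($\chi_C(e)=1$ iff $e\in E(C)$). The hole space $\mathcal{H}(G)$ is the $\mathbb{F}_2$-linear span of $\{\chi_C : C \text{ a hole of } G\}$ in the vector space $\mathbb{F}_2^{E(G)}$, and $\dim\mathcal{H}(G)$ is its dimension over $\mathbb{F}_2$. -}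

module Defs where

open import Data.Bool using (Bool; true; false; _∧_; _∨_; _xor_)
open import Data.Nat using (ℕ; zero; suc; _+_; _≤_; _<_; s≤s)
open import Data.Nat.Properties using (_<?_)
open import Data.Fin using (Fin; zero; suc; toℕ; fromℕ<; splitAt; _≟_)
open import Data.Sum using (_⊎_; inj₁; inj₂)
open import Data.Product using (Σ; _×_; _,_; proj₁; proj₂; ∃)
open import Data.List using (List; map; foldr)
open import Data.Empty using (⊥)
open import Relation.Nullary using (¬_; yes; no)
open import Relation.Nullary.Decidable using (⌊_⌋)
open import Relation.Binary.PropositionalEquality using (_≡_; _≢_)

record Graph (n : ℕ) : Set where
  field
    adj    : Fin n → Fin n → Bool
    sym    : ∀ i j → adj i j ≡ adj j i
    irrefl : ∀ i → adj i i ≡ false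
open Graph public

data Reach {n : ℕ} (G : Graph n) : Fin n → Fin n → Set where
  here : ∀ {x} → Reach G x x
  step : ∀ {x y z} → adj G x y ≡ true → Reach G y z → Reach G x z

Connected : ∀ {n} → Graph n → Set
Connected G = ∀ x y → Reach G x y

TriangleFree : ∀ {n} → Graph n → Set
TriangleFree G = ∀ x y z → adj G x y ≡ true → adj G y z ≡ true → adj G x z ≡ true → ⊥

Digraph : ℕ → Set
Digraph m = Fin m → Fin m → Bool

data DPath {m : ℕ} (A : Digraph m) : Fin m → Fin m → Set where
  arc  : ∀ {x y} → A x y ≡ true → DPath A x y
  _∷ᵈ_ : ∀ {x y z} → A x y ≡ true → DPath A y z → DPath A x z

Acyclic : ∀ {m} → Digraph m → Set
Acyclic A = ∀ x → ¬ DPath A x x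

-- adjacency of G ∪ I_k : G together with k new isolated vertices,
-- the new vertices being the last k elements of Fin (n + k)
addIsolated : ∀ {n} → Graph n → (k : ℕ) → Fin (n + k) → Fin (n + k) → Bool
addIsolated {n} G k x y with splitAt n x | splitAt n y
... | inj₁ i | inj₁ j = adj G i j
... | _      | _      = false

IsCompetitionGraphOf : ∀ {n} → Graph n → (k : ℕ) → Digraph (n + k) → Set
IsCompetitionGraphOf G k A =
  ∀ x y → x ≢ y →
    ((∃ λ v → A x v ≡ true × A y v ≡ true) → addIsolated G k x y ≡ true) ×
    (addIsolated G k x y ≡ true → ∃ λ v → A x v ≡ true × A y v ≡ true)

CompRep : ∀ {n} → Graph n → ℕ → Set
CompRep {n} G k = Σ (Digraph (n + k)) λ A → Acyclic A × IsCompetitionGraphOf G k A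

IsCompetitionNumber : ∀ {n} → Graph n → ℕ → Set
IsCompetitionNumber G k = CompRep G k × (∀ j → j < k → ¬ CompRep G j)

-- edges {i,j} represented once, as (i , j) with i < j
Edge : ∀ {n} → Graph n → Set
Edge {n} G = Σ (Fin n × Fin n) λ p → (toℕ (proj₁ p) < toℕ (proj₂ p)) × (adj G (proj₁ p) (proj₂ p) ≡ true)

-- vectors of F₂^{E(G)} (Bool = F₂, addition = xor)
EVec : ∀ {n} → Graph n → Set
EVec G = Edge G → Bool

next : ∀ {k} → Fin (suc k) → Fin (suc k)
next {k} i with toℕ i <? k
... | yes p = fromℕ< (s≤s p)
... | no _  = zero

-- a hole: an induced cycle f 0, f 1, ..., f k, f 0 of length suc k ≥ 4
record Hole {n : ℕ} (G : Graph n) : Set where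
  field
    len-1   : ℕ
    long    : 3 ≤ len-1
    vtx     : Fin (suc len-1) → Fin n
    inj     : ∀ s t → vtx s ≡ vtx t → s ≡ t
    consec  : ∀ t → adj G (vtx t) (vtx (next t)) ≡ true
    induced : ∀ s t → adj G (vtx s) (vtx t) ≡ true → (t ≡ next s) ⊎ (s ≡ next t)
open Hole public

anyFin : ∀ {m} → (Fin m → Bool) → Bool
anyFin {zero}  f = false
anyFin {suc m} f = f zero ∨ anyFin (λ i → f (suc i))

sameEdge : ∀ {n} → Fin n → Fin n → Fin n → Fin n → Bool
sameEdge a b i j = (⌊ a ≟ i ⌋ ∧ ⌊ b ≟ j ⌋) ∨ (⌊ a ≟ j ⌋ ∧ ⌊ b ≟ i ⌋)

χ : ∀ {n} {G : Graph n} → Hole G → EVec G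
χ C ((i , j) , _) = anyFin (λ t → sameEdge (vtx C t) (vtx C (next t)) i j)

InHoleSpace : ∀ {n} (G : Graph n) → EVec G → Set
InHoleSpace G v = Σ (List (Hole G)) λ L → ∀ e → v e ≡ foldr _xor_ false (map (λ C → χ C e) L)

lincomb : ∀ {n} (G : Graph n) {d : ℕ} → (Fin d → Bool) → (Fin d → EVec G) → EVec G
lincomb G {zero}  c b e = false
lincomb G {suc d} c b e = (c zero ∧ b zero e) xor lincomb G (λ i → c (suc i)) (λ i → b (suc i)) e

LinIndep : ∀ {n} (G : Graph n) {d : ℕ} → (Fin d → EVec G) → Set
LinIndep G {d} b = ∀ (c : Fin d → Bool) → (∀ e → lincomb G c b e ≡ false) → ∀ i → c i ≡ false

InSpan : ∀ {n} (G : Graph n) {d : ℕ} → (Fin d → EVec G) → EVec G → Set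
InSpan G {d} b v = Σ (Fin d → Bool) λ c → ∀ e → v e ≡ lincomb G c b e

HoleSpaceDim : ∀ {n} → Graph n → ℕ → Set
HoleSpaceDim G d =
  Σ (Fin d → EVec G) λ b →
    (∀ i → InHoleSpace G (b i)) × LinIndep G b × (∀ v → InHoleSpace G v → InSpan G b v)

module Submission where

-- Fix a spanning tree of G on its n + 1 vertices, presented as an ordering
-- of the vertices in which each vertex but the last (the root) has a later
-- neighbour, its parent.  The n edges {c, parent c} are the tree edges; let
-- r be the number of remaining, non-tree, edges.  We show dim 𝓗(G) = r and
-- k(G) = r + 1.
--
--  * Linear algebra over F₂ (F₂, Counting, EdgeSpace): the dimension of a
--    space is well defined, by counting the coefficient vectors.
--  * The hole space (ClosedWalks, HoleSpan, CutEquations, FundamentalCycles):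
--    in a triangle-free graph the edge vector of every closed walk lies in
--    𝓗(G), because a closed walk that is not a hole splits at a repeated
--    vertex or a chord into shorter ones; in particular the r fundamental
--    cycles of the tree do.  Conversely every vector of 𝓗(G) satisfies the
--    cut equations of the tree, so it is determined by its coordinates at
--    the non-tree edges.  Hence the fundamental cycles form a basis.
--  * The competition number (UpperBound, LowerBound): an explicit acyclic
--    digraph represents G with r + 1 new vertices; and in every
--    representation the n + r edges need pairwise distinct common
--    out-neighbours (by triangle-freeness), none of which can be a source
--    or a minimal vertex of what remains after removing that source.

open import Defs
open import Data.Nat using (ℕ; zero; suc; _+_; _≤_; s≤s)
open import Data.Nat.Properties using (<⇒≱)
open import Data.Product using (Σ; _×_; _,_)
open import Relation.Binary.PropositionalEquality using (subst)


module Basics where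

  open import Data.Bool using (Bool; true; false; _∨_)
  open import Data.Nat using (_<_)
  open import Data.Nat.Properties using (<-cmp)
  open import Data.Fin using (Fin; toℕ)
  open import Data.Fin.Properties using (toℕ-injective; all?; ¬∀⟶∃¬)
  open import Data.Product using (Σ; _×_; _,_)
  open import Data.Sum using (_⊎_; inj₁; inj₂)
  open import Data.Empty using (⊥-elim)
  open import Relation.Nullary using (¬_; Dec; yes; no)
  open import Relation.Nullary.Decidable using (⌊_⌋; _→-dec_)
  open import Relation.Binary.Definitions using (tri<; tri≈; tri>)
  open import Relation.Binary.PropositionalEquality using (_≡_; _≢_; refl)

  true≢false : true ≢ false
  true≢false ()

  ∨-true : ∀ x y → x ∨ y ≡ true → x ≡ true ⊎ y ≡ true
  ∨-true true  _    _ = inj₁ refl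
  ∨-true false true _ = inj₂ refl

  isYes-sound : ∀ {P : Set} (P? : Dec P) → ⌊ P? ⌋ ≡ true → P
  isYes-sound (yes p) _ = p

  isYes-complete : ∀ {P : Set} (P? : Dec P) → P → ⌊ P? ⌋ ≡ true
  isYes-complete (yes _) _ = refl
  isYes-complete (no ¬p) p = ⊥-elim (¬p p)

  violation : ∀ {m} {A B : Fin m → Fin m → Set} → (∀ s t → Dec (A s t)) → (∀ s t → Dec (B s t)) →
    ¬ (∀ s t → A s t → B s t) → Σ (Fin m) λ s → Σ (Fin m) λ t → A s t × ¬ B s t
  violation {m} {A} {B} A? B? fails
    with ¬∀⟶∃¬ m _ (λ s → all? λ t → A? s t →-dec B? s t) fails
  ... | s , fails-at-s with ¬∀⟶∃¬ m _ (λ t → A? s t →-dec B? s t) fails-at-s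
  ...   | t , fails-at-st with A? s t | B? s t
  ...     | yes a  | no ¬b = s , t , a , ¬b
  ...     | yes _  | yes b = ⊥-elim (fails-at-st λ _ → b)
  ...     | no  ¬a | _     = ⊥-elim (fails-at-st λ a → ⊥-elim (¬a a))

  ordered : ∀ {m} (s t : Fin m) → s ≢ t → toℕ s < toℕ t ⊎ toℕ t < toℕ s
  ordered s t s≢t with <-cmp (toℕ s) (toℕ t)
  ... | tri< s<t _ _ = inj₁ s<t
  ... | tri≈ _ s≡t _ = ⊥-elim (s≢t (toℕ-injective s≡t))
  ... | tri> _ _ t<s = inj₂ t<s

-- Finite sums over the two-element field F₂ = (Bool, xor, ∧).  We use the
-- library's summation over the Boolean ring, whose sums unfold definitionally
-- as  sum f = f zero xor sum (f ∘ suc).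
module F₂ where

  open import Data.Bool using (Bool; true; false; _xor_)
  open import Data.Bool.Properties using (xor-∧-commutativeRing; xor-identityʳ)
  open import Data.Fin using (Fin; zero; suc)
  open import Data.Fin.Properties using (suc-injective)
  open import Algebra.Bundles using (CommutativeRing)
  open import Relation.Binary.PropositionalEquality using (_≡_; _≢_; refl; cong)
  import Relation.Binary.PropositionalEquality as ≡
  open CommutativeRing xor-∧-commutativeRing using (semiring)

  open import Algebra.Properties.Semiring.Sum semiring public
    using (sum; sum-syntax; sum-cong-≗; ∑-distrib-+; ∑-comm; *-distribˡ-sum; *-distribʳ-sum; sum-init-last)

  xor≡false⇒≡ : ∀ a b → a xor b ≡ false → a ≡ b
  xor≡false⇒≡ true  true  _ = refl
  xor≡false⇒≡ false false _ = refl

  sum-zero : ∀ {m} (f : Fin m → Bool) → (∀ i → f i ≡ false) → sum f ≡ false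
  sum-zero {zero}  f f≡0 = refl
  sum-zero {suc m} f f≡0 rewrite f≡0 zero = sum-zero (λ i → f (suc i)) (λ i → f≡0 (suc i))

  sum-single : ∀ {m} (f : Fin m → Bool) (k : Fin m) → (∀ i → i ≢ k → f i ≡ false) → sum f ≡ f k
  sum-single {suc m} f zero others
    rewrite sum-zero (λ i → f (suc i)) (λ i → others (suc i) (λ ())) = xor-identityʳ (f zero)
  sum-single {suc m} f (suc k) others
    rewrite others zero (λ ()) = sum-single (λ i → f (suc i)) k (λ i i≢k → others (suc i) (λ eq → i≢k (suc-injective eq)))

  anyFin≡sum : ∀ {m} (f : Fin m → Bool) → (∀ s t → f s ≡ true → f t ≡ true → s ≡ t) → anyFin f ≡ sum f
  anyFin≡sum {zero}  f unique = refl
  anyFin≡sum {suc m} f unique with f zero in f₀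
  ... | true  = ≡.sym (cong (true xor_) (sum-zero (λ i → f (suc i)) rest))
    where
    rest : ∀ i → f (suc i) ≡ false
    rest i with f (suc i) in fᵢ
    ... | false = refl
    ... | true  with unique zero (suc i) f₀ fᵢ
    ... | ()
  ... | false = anyFin≡sum (λ i → f (suc i)) (λ s t fs ft → suc-injective (unique (suc s) (suc t) fs ft))

module Counting where

  open import Data.Bool using (Bool)
  open import Data.Nat using (_^_; z≤n)
  open import Data.Nat.Properties using (^-monoʳ-<; <⇒≱; ≮⇒≥)
  open import Data.Fin using (Fin; zero; suc; funToFin; finToFun; combine; punchOut)
  open import Data.Fin.Properties using (injective⇒≤; punchOut-injective; funToFin-finToFin; finToFun-funToFin; 2↔Bool)
  open import Function.Bundles using (Inverse)
  open import Relation.Binary.PropositionalEquality using (_≡_; _≢_; _≗_; refl; cong; cong₂; trans)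
  import Relation.Binary.PropositionalEquality as ≡

  -- Bool ≅ Fin 2, so that Boolean vectors can be coded as numbers below 2^p
  open Inverse 2↔Bool using (strictlyInverseˡ; strictlyInverseʳ)
    renaming (to to fromFin2; from to toFin2)

  toFin2-injective : ∀ x y → toFin2 x ≡ toFin2 y → x ≡ y
  toFin2-injective x y eq = trans (≡.sym (strictlyInverseˡ x)) (trans (cong fromFin2 eq) (strictlyInverseˡ y))

  fromFin2-injective : ∀ x y → fromFin2 x ≡ fromFin2 y → x ≡ y
  fromFin2-injective x y eq = trans (≡.sym (strictlyInverseʳ x)) (trans (cong toFin2 eq) (strictlyInverseʳ y))

  funToFin-cong : ∀ {m k} {f g : Fin m → Fin k} → f ≗ g → funToFin f ≡ funToFin g
  funToFin-cong {zero}  f≗g = refl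
  funToFin-cong {suc m} f≗g = cong₂ combine (f≗g zero) (funToFin-cong (λ i → f≗g (suc i)))

  cube-injection⇒≤ : ∀ {p q} (F : (Fin p → Bool) → (Fin q → Bool)) →
    (∀ c c′ → F c ≗ F c′ → c ≗ c′) → p ≤ q
  cube-injection⇒≤ {p} {q} F F-inj = ≮⇒≥ λ q<p → <⇒≱ (^-monoʳ-< 2 (s≤s (s≤s z≤n)) q<p) (injective⇒≤ code-injective)
    where
    digits : Fin (2 ^ p) → Fin p → Fin 2
    digits = finToFun {2} {p}
    decode : Fin (2 ^ p) → Fin p → Bool
    decode x i = fromFin2 (digits x i)
    code : Fin (2 ^ p) → Fin (2 ^ q)
    code x = funToFin (λ j → toFin2 (F (decode x) j))
    code-injective : ∀ {x y} → code x ≡ code y → x ≡ y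
    code-injective {x} {y} eq = begin
      x                        ≡⟨ funToFin-finToFin {p} {2} x ⟨
      funToFin (digits x)      ≡⟨ funToFin-cong same-digits ⟩
      funToFin (digits y)      ≡⟨ funToFin-finToFin {p} {2} y ⟩
      y                        ∎
      where
      open ≡.≡-Reasoning
      same-image : F (decode x) ≗ F (decode y)
      same-image j = toFin2-injective _ _ (begin
        toFin2 (F (decode x) j)  ≡⟨ finToFun-funToFin _ j ⟨
        finToFun {2} {q} (code x) j  ≡⟨ cong (λ z → finToFun z j) eq ⟩
        finToFun {2} {q} (code y) j  ≡⟨ finToFun-funToFin _ j ⟩
        toFin2 (F (decode y) j)  ∎)
      same-digits : digits x ≗ digits y
      same-digits i = fromFin2-injective _ _ (F-inj (decode x) (decode y) same-image i)

  injection-avoiding-two : ∀ {a m} (f : Fin a → Fin (suc (suc m))) → (∀ i i′ → f i ≡ f i′ → i ≡ i′) →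
    ∀ {s b} → s ≢ b → (∀ i → s ≢ f i) → (∀ i → b ≢ f i) → a ≤ m
  injection-avoiding-two {a} {m} f f-inj {s} {b} s≢b s-missed b-missed = injective⇒≤ {f = g} g-injective
    where
    f′ : Fin a → Fin (suc m)
    f′ i = punchOut (s-missed i)
    b′ : Fin (suc m)
    b′ = punchOut s≢b
    b′-missed : ∀ i → b′ ≢ f′ i
    b′-missed i eq = b-missed i (punchOut-injective s≢b (s-missed i) eq)
    g : Fin a → Fin m
    g i = punchOut (b′-missed i)
    g-injective : ∀ {i i′} → g i ≡ g i′ → i ≡ i′
    g-injective {i} {i′} eq =
      f-inj i i′ (punchOut-injective (s-missed i) (s-missed i′) (punchOut-injective (b′-missed i) (b′-missed i′) eq))

module Enumerations where

  open import Data.Fin using (Fin; zero; suc)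
  open import Data.Fin.Properties using (suc-injective)
  open import Data.Product using (Σ; _,_)
  open import Data.Empty using (⊥-elim)
  open import Relation.Nullary using (yes; no)
  open import Level using (0ℓ)
  open import Relation.Unary using (Pred; Decidable)
  open import Relation.Binary.PropositionalEquality using (_≡_; refl; cong)

  record Enumeration (M : ℕ) (P : Pred (Fin M) 0ℓ) : Set where
    field
      size     : ℕ
      elem     : Fin size → Fin M
      elem-P   : ∀ k → P (elem k)
      elem-inj : ∀ k k′ → elem k ≡ elem k′ → k ≡ k′
      complete : ∀ x → P x → Σ (Fin size) λ k → elem k ≡ x

  enumerate : ∀ {M} (P : Pred (Fin M) 0ℓ) → Decidable P → Enumeration M P
  enumerate {zero} P P? = record
    { size = 0 ; elem = λ () ; elem-P = λ () ; elem-inj = λ () ; complete = λ () }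
  enumerate {suc M} P P? with enumerate (λ x → P (suc x)) (λ x → P? (suc x)) | P? zero
  ... | E | no ¬P0 = record
    { size     = size
    ; elem     = λ k → suc (elem k)
    ; elem-P   = elem-P
    ; elem-inj = λ k k′ eq → elem-inj k k′ (suc-injective eq)
    ; complete = complete′
    }
    where
    open Enumeration E
    complete′ : ∀ x → P x → Σ (Fin size) λ k → suc (elem k) ≡ x
    complete′ zero    px = ⊥-elim (¬P0 px)
    complete′ (suc x) px with complete x px
    ... | k , eq = k , cong suc eq
  ... | E | yes P0 = record
    { size = suc size ; elem = elem′ ; elem-P = elem-P′ ; elem-inj = elem-inj′ ; complete = complete′ }
    where
    open Enumeration E
    elem′ : Fin (suc size) → Fin (suc M)
    elem′ zero    = zero
    elem′ (suc k) = suc (elem k)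
    elem-P′ : ∀ k → P (elem′ k)
    elem-P′ zero    = P0
    elem-P′ (suc k) = elem-P k
    elem-inj′ : ∀ k k′ → elem′ k ≡ elem′ k′ → k ≡ k′
    elem-inj′ zero    zero     _  = refl
    elem-inj′ (suc k) (suc k′) eq = cong suc (elem-inj k k′ (suc-injective eq))
    complete′ : ∀ x → P x → Σ (Fin (suc size)) λ k → elem′ k ≡ x
    complete′ zero    px = zero , refl
    complete′ (suc x) px with complete x px
    ... | k , eq = suc k , cong suc eq

-- The key fact is that the
-- dimension of a subspace is well defined: independent vectors lying in the
-- span of q vectors number at most q.  We count: the coefficient map
-- F₂^p → F₂^q it induces is injective, hence 2^p ≤ 2^q.
module EdgeSpace {N : ℕ} (G : Graph N) where

  open import Data.Bool using (Bool; false; _∧_; _xor_)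
  open import Data.Bool.Properties using (∧-assoc; ∧-distribʳ-xor; xor-same)
  open import Data.Fin using (Fin; zero; suc)
  open import Data.Nat.Properties using (≤-antisym)
  open import Data.Product using (_,_; proj₁; proj₂)
  open import Relation.Binary.PropositionalEquality using (_≡_; _≗_; refl; cong; cong₂; trans)
  import Relation.Binary.PropositionalEquality as ≡
  open ≡.≡-Reasoning
  open F₂
  open Counting

  lincomb≡sum : ∀ {d} (c : Fin d → Bool) (b : Fin d → EVec G) e →
    lincomb G c b e ≡ ∑[ i < d ] (c i ∧ b i e)
  lincomb≡sum {zero}  c b e = refl
  lincomb≡sum {suc d} c b e = cong ((c zero ∧ b zero e) xor_) (lincomb≡sum (λ i → c (suc i)) (λ i → b (suc i)) e)

  lincomb-xor : ∀ {d} (c c′ : Fin d → Bool) (b : Fin d → EVec G) e →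
    lincomb G (λ i → c i xor c′ i) b e ≡ lincomb G c b e xor lincomb G c′ b e
  lincomb-xor {d} c c′ b e = begin
    lincomb G (λ i → c i xor c′ i) b e                ≡⟨ lincomb≡sum _ b e ⟩
    ∑[ i < d ] ((c i xor c′ i) ∧ b i e)               ≡⟨ sum-cong-≗ (λ i → ∧-distribʳ-xor (b i e) (c i) (c′ i)) ⟩
    ∑[ i < d ] ((c i ∧ b i e) xor (c′ i ∧ b i e))     ≡⟨ ∑-distrib-+ (λ i → c i ∧ b i e) (λ i → c′ i ∧ b i e) ⟩
    ∑[ i < d ] (c i ∧ b i e) xor ∑[ i < d ] (c′ i ∧ b i e)
      ≡⟨ cong₂ _xor_ (lincomb≡sum c b e) (lincomb≡sum c′ b e) ⟨
    lincomb G c b e xor lincomb G c′ b e              ∎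

  lincomb-cong : ∀ {d} {c c′ : Fin d → Bool} (b : Fin d → EVec G) → c ≗ c′ → ∀ e → lincomb G c b e ≡ lincomb G c′ b e
  lincomb-cong {c = c} {c′} b c≗c′ e = begin
    lincomb G c b e          ≡⟨ lincomb≡sum c b e ⟩
    ∑[ i < _ ] (c i ∧ b i e)  ≡⟨ sum-cong-≗ (λ i → cong (_∧ b i e) (c≗c′ i)) ⟩
    ∑[ i < _ ] (c′ i ∧ b i e) ≡⟨ lincomb≡sum c′ b e ⟨
    lincomb G c′ b e         ∎

  module _ {p q} (u : Fin p → EVec G) (w : Fin q → EVec G)
           (indep : LinIndep G u) (in-span : ∀ i → InSpan G w (u i)) where

    a : Fin p → Fin q → Bool
    a i = proj₁ (in-span i)

    coeff : (Fin p → Bool) → Fin q → Bool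
    coeff c j = ∑[ i < p ] (c i ∧ a i j)

    lincomb-coeff : ∀ c e → lincomb G c u e ≡ lincomb G (coeff c) w e
    lincomb-coeff c e = begin
      lincomb G c u e
        ≡⟨ lincomb≡sum c u e ⟩
      ∑[ i < p ] (c i ∧ u i e)
        ≡⟨ sum-cong-≗ (λ i → cong (c i ∧_) (trans (proj₂ (in-span i) e) (lincomb≡sum (a i) w e))) ⟩
      ∑[ i < p ] (c i ∧ ∑[ j < q ] (a i j ∧ w j e))
        ≡⟨ sum-cong-≗ (λ i → *-distribˡ-sum (c i) (λ j → a i j ∧ w j e)) ⟩
      ∑[ i < p ] ∑[ j < q ] (c i ∧ (a i j ∧ w j e))
        ≡⟨ ∑-comm (λ i j → c i ∧ (a i j ∧ w j e)) ⟩
      ∑[ j < q ] ∑[ i < p ] (c i ∧ (a i j ∧ w j e))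
        ≡⟨ sum-cong-≗ (λ j → sum-cong-≗ (λ i → ∧-assoc (c i) (a i j) (w j e))) ⟨
      ∑[ j < q ] ∑[ i < p ] ((c i ∧ a i j) ∧ w j e)
        ≡⟨ sum-cong-≗ (λ j → *-distribʳ-sum (w j e) (λ i → c i ∧ a i j)) ⟨
      ∑[ j < q ] (coeff c j ∧ w j e)
        ≡⟨ lincomb≡sum (coeff c) w e ⟨
      lincomb G (coeff c) w e
        ∎

    coeff-injective : ∀ c c′ → coeff c ≗ coeff c′ → c ≗ c′
    coeff-injective c c′ same i = xor≡false⇒≡ (c i) (c′ i) (indep (λ i → c i xor c′ i) vanishes i)
      where
      vanishes : ∀ e → lincomb G (λ i → c i xor c′ i) u e ≡ false
      vanishes e = begin
        lincomb G (λ i → c i xor c′ i) u e                     ≡⟨ lincomb-xor c c′ u e ⟩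
        lincomb G c u e xor lincomb G c′ u e                   ≡⟨ cong₂ _xor_ (lincomb-coeff c e) (lincomb-coeff c′ e) ⟩
        lincomb G (coeff c) w e xor lincomb G (coeff c′) w e   ≡⟨ cong (lincomb G (coeff c) w e xor_) (lincomb-cong w same e) ⟨
        lincomb G (coeff c) w e xor lincomb G (coeff c) w e    ≡⟨ xor-same (lincomb G (coeff c) w e) ⟩
        false                                                  ∎

    independent-in-span⇒≤ : p ≤ q
    independent-in-span⇒≤ = cube-injection⇒≤ coeff coeff-injective

  HoleSpaceDim-unique : ∀ {d d′} → HoleSpaceDim G d → HoleSpaceDim G d′ → d ≡ d′
  HoleSpaceDim-unique (b , b∈𝓗 , b-indep , b-spans) (b′ , b′∈𝓗 , b′-indep , b′-spans) = ≤-antisym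
    (independent-in-span⇒≤ b b′ b-indep (λ i → b′-spans (b i) (b∈𝓗 i)))
    (independent-in-span⇒≤ b′ b b′-indep (λ i → b-spans (b′ i) (b′∈𝓗 i)))

module CyclicIndex where

  open import Data.Bool using (Bool; false; _xor_)
  open import Data.Bool.Properties using (xor-comm; xor-same)
  open import Data.Nat using (_<_; z<s)
  open import Data.Nat.Properties using (_<?_; ≤-antisym; ≮⇒≥; <-irrefl; <-trans)
  open import Data.Fin using (Fin; zero; suc; toℕ; fromℕ; inject₁)
  open import Data.Fin.Properties using (toℕ-fromℕ<; toℕ≤pred[n]; toℕ-injective; toℕ-inject₁; toℕ<n; toℕ-fromℕ)
  open import Data.Product using (_×_; _,_)
  open import Data.Sum using (_⊎_; inj₁; inj₂)
  open import Data.Empty using (⊥-elim)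
  open import Relation.Nullary using (yes; no)
  open import Relation.Binary.PropositionalEquality using (_≡_; _≢_; refl; cong; cong₂; trans)
  import Relation.Binary.PropositionalEquality as ≡
  open ≡.≡-Reasoning
  open F₂

  next-cases : ∀ {k} (t : Fin (suc k)) →
    (toℕ t < k × toℕ (next t) ≡ suc (toℕ t)) ⊎ (toℕ t ≡ k × next t ≡ zero)
  next-cases {k} t with toℕ t <? k
  ... | yes t<k = inj₁ (t<k , toℕ-fromℕ< (s≤s t<k))
  ... | no  t≮k = inj₂ (≤-antisym (toℕ≤pred[n] t) (≮⇒≥ t≮k) , refl)

  toℕ-next : ∀ {k} (t : Fin (suc k)) → toℕ t < k → toℕ (next t) ≡ suc (toℕ t)
  toℕ-next t t<k with next-cases t
  ... | inj₁ (_ , forward) = forward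
  ... | inj₂ (last , _)    = ⊥-elim (<-irrefl last t<k)

  next-last : ∀ {k} (t : Fin (suc k)) → toℕ t ≡ k → next t ≡ zero
  next-last t last with next-cases t
  ... | inj₁ (t<k , _) = ⊥-elim (<-irrefl last t<k)
  ... | inj₂ (_ , wrap) = wrap

  next-inject₁ : ∀ {k} (i : Fin k) → next (inject₁ i) ≡ suc i
  next-inject₁ {k} i with next-cases (inject₁ i)
  ... | inj₁ (_ , eq) = toℕ-injective (trans eq (cong suc (toℕ-inject₁ i)))
  ... | inj₂ (last , _) = ⊥-elim (<-irrefl (trans (≡.sym (toℕ-inject₁ i)) last) (toℕ<n i))

  next-fromℕ : ∀ k → next (fromℕ k) ≡ zero
  next-fromℕ k = next-last (fromℕ k) (toℕ-fromℕ k)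

  next-next≢ : ∀ {k} → 2 ≤ k → (t : Fin (suc k)) → next (next t) ≢ t
  next-next≢ {k} 1<k t eq with next-cases t | next-cases (next t)
  ... | inj₁ (_ , step₁) | inj₁ (_ , step₂) = m≢2+m (begin
    toℕ t                    ≡⟨ cong toℕ eq ⟨
    toℕ (next (next t))      ≡⟨ step₂ ⟩
    suc (toℕ (next t))       ≡⟨ cong suc step₁ ⟩
    suc (suc (toℕ t))        ∎)
    where
    m≢2+m : ∀ {m} → m ≢ suc (suc m)
    m≢2+m ()
  ... | inj₁ (_ , step₁) | inj₂ (last , wrap) = <-irrefl (begin
    1                        ≡⟨ cong (λ z → suc (toℕ z)) (trans (≡.sym eq) wrap) ⟨
    suc (toℕ t)              ≡⟨ step₁ ⟨
    toℕ (next t)             ≡⟨ last ⟩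
    k                        ∎) 1<k
  ... | inj₂ (last , wrap) | inj₁ (_ , step₂) = <-irrefl (begin
    1                        ≡⟨ cong (λ z → suc (toℕ z)) wrap ⟨
    suc (toℕ (next t))       ≡⟨ step₂ ⟨
    toℕ (next (next t))      ≡⟨ cong toℕ eq ⟩
    toℕ t                    ≡⟨ last ⟩
    k                        ∎) 1<k
  ... | inj₂ (_ , wrap) | inj₂ (last , _) = <-irrefl (trans (≡.sym (cong toℕ wrap)) last) (<-trans z<s 1<k)

  sum-rotate : ∀ {k} (h : Fin (suc k) → Bool) → ∑[ t < suc k ] h (next t) ≡ sum h
  sum-rotate {k} h = begin
    ∑[ t < suc k ] h (next t)                            ≡⟨ sum-init-last (λ t → h (next t)) ⟩
    ∑[ i < k ] h (next (inject₁ i)) xor h (next (fromℕ k))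
      ≡⟨ cong₂ _xor_ (sum-cong-≗ (λ i → cong h (next-inject₁ i))) (cong h (next-fromℕ k)) ⟩
    ∑[ i < k ] h (suc i) xor h zero                       ≡⟨ xor-comm _ (h zero) ⟩
    sum h                                                 ∎

  telescope : ∀ {k} (g : Fin (suc k) → Bool) → ∑[ t < suc k ] (g t xor g (next t)) ≡ false
  telescope {k} g = begin
    ∑[ t < suc k ] (g t xor g (next t))           ≡⟨ ∑-distrib-+ g (λ t → g (next t)) ⟩
    sum g xor ∑[ t < suc k ] g (next t)            ≡⟨ cong (sum g xor_) (sum-rotate g) ⟩
    sum g xor sum g                                ≡⟨ xor-same (sum g) ⟩
    false                                          ∎

-- A spanning tree of a connected graph on n + 1 vertices, presented as an
-- ordering  ord : Fin (n+1) ≅ V  in which every vertex v other than the last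
-- one (the root) has a neighbour  parent v  occurring strictly later.
module SpanningTree {n : ℕ} (G : Graph (suc n)) (connected : Connected G) where

  open import Data.Bool using (true)
  open import Data.Nat using (_<_; z≤n)
  open import Data.Nat.Properties using (<-irrefl; ≤-refl; ≤-trans; ≤-pred; <⇒≤; +-suc; +-monoʳ-≤)
  open import Data.Fin using (Fin; zero; suc; toℕ; fromℕ; _≟_)
  open import Data.Fin.Properties using (toℕ-injective; any?; all?; ¬∀⟶∃¬; toℕ≤pred[n]; toℕ-fromℕ; injective⇒≤)
  open import Data.Product using (Σ; ∃; _×_; _,_; proj₁; proj₂)
  open import Data.Empty using (⊥-elim)
  open import Relation.Nullary using (¬_; Dec; yes; no)
  open import Relation.Binary.PropositionalEquality using (_≡_; refl; cong; subst; trans)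
  import Relation.Binary.PropositionalEquality as ≡

  V : Set
  V = Fin (suc n)

  -- A tree on m + 1 distinct vertices  vertex 0, …, vertex m, built by adding
  -- leaves in front, so that each vertex but the last has a later parent.
  record PartialTree (m : ℕ) : Set where
    field
      vertex     : Fin (suc m) → V
      vertex-inj : ∀ i j → vertex i ≡ vertex j → i ≡ j
      parent     : Fin (suc m) → Fin (suc m)
      parent-ok  : ∀ i → toℕ i < m → toℕ i < toℕ (parent i) × adj G (vertex i) (vertex (parent i)) ≡ true
  open PartialTree

  single : PartialTree 0
  single = record
    { vertex = λ _ → zero ; vertex-inj = λ { zero zero _ → refl } ; parent = λ i → i ; parent-ok = λ { zero () } }

  Covers : ∀ {m} → PartialTree m → V → Set
  Covers T v = ∃ λ i → vertex T i ≡ v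

  covers? : ∀ {m} (T : PartialTree m) v → Dec (Covers T v)
  covers? T v = any? (λ i → vertex T i ≟ v)

  leaving-edge : ∀ {m} (T : PartialTree m) {x y} → Reach G x y → Covers T x → ¬ Covers T y →
    Σ V λ u → Σ V λ w → Covers T u × ¬ Covers T w × adj G u w ≡ true
  leaving-edge T here          x∈T y∉T = ⊥-elim (y∉T x∈T)
  leaving-edge T (step {x} {y} xy walk) x∈T z∉T with covers? T y
  ... | yes y∈T = leaving-edge T walk y∈T z∉T
  ... | no  y∉T = x , y , x∈T , y∉T , xy

  attach : ∀ {m} (T : PartialTree m) (w : V) → ¬ Covers T w →
    (j : Fin (suc m)) → adj G w (vertex T j) ≡ true → PartialTree (suc m)
  attach {m} T w w∉T j wj = record
    { vertex = vertex′ ; vertex-inj = vertex-inj′ ; parent = parent′ ; parent-ok = parent-ok′ }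
    where
    vertex′ : Fin (suc (suc m)) → V
    vertex′ zero    = w
    vertex′ (suc i) = vertex T i
    vertex-inj′ : ∀ i i′ → vertex′ i ≡ vertex′ i′ → i ≡ i′
    vertex-inj′ zero    zero     _  = refl
    vertex-inj′ zero    (suc i′) eq = ⊥-elim (w∉T (i′ , ≡.sym eq))
    vertex-inj′ (suc i) zero     eq = ⊥-elim (w∉T (i , eq))
    vertex-inj′ (suc i) (suc i′) eq = cong suc (vertex-inj T i i′ eq)
    parent′ : Fin (suc (suc m)) → Fin (suc (suc m))
    parent′ zero    = suc j
    parent′ (suc i) = suc (parent T i)
    parent-ok′ : ∀ i → toℕ i < suc m → toℕ i < toℕ (parent′ i) × adj G (vertex′ i) (vertex′ (parent′ i)) ≡ true
    parent-ok′ zero    _         = s≤s z≤n , wj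
    parent-ok′ (suc i) (s≤s i<m) with parent-ok T i i<m
    ... | later , adjacent = s≤s later , adjacent

  grow : ∀ {m} (T : PartialTree m) → ¬ (∀ v → Covers T v) → PartialTree (suc m)
  grow T not-spanning with ¬∀⟶∃¬ _ (Covers T) (covers? T) not-spanning
  ... | v , v∉T with leaving-edge T (connected (vertex T zero) v) (zero , refl) v∉T
  ... | u , w , (j , refl) , w∉T , uw = attach T w w∉T j (trans (Graph.sym G w (vertex T j)) uw)

  spanning⇒size : ∀ {m} (T : PartialTree m) → (∀ v → Covers T v) → n ≤ m
  spanning⇒size T spans = ≤-pred (injective⇒≤ {f = λ v → proj₁ (spans v)} position-inj)
    where
    position-inj : ∀ {v w} → proj₁ (spans v) ≡ proj₁ (spans w) → v ≡ w
    position-inj {v} {w} eq = trans (≡.sym (proj₂ (spans v))) (trans (cong (vertex T) eq) (proj₂ (spans w)))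

  build : ∀ m → m ≤ n → PartialTree m
  build zero    _   = single
  build (suc m) m<n with build m (<⇒≤ m<n)
  ... | T with all? (covers? T)
  ...   | yes spans = ⊥-elim (<-irrefl refl (≤-trans m<n (spanning⇒size T spans)))
  ...   | no  not-spanning = grow T not-spanning

  abstract
    tree : PartialTree n
    tree = build n ≤-refl

    tree-spans : ∀ v → Covers tree v
    tree-spans v with covers? tree v
    ... | yes v∈T = v∈T
    ... | no  v∉T = ⊥-elim (<-irrefl refl (injective⇒≤ {f = vertex bigger} (vertex-inj bigger _ _)))
      where
      bigger : PartialTree (suc n)
      bigger = grow tree (λ spans → v∉T (spans v))

  ord : Fin (suc n) → V
  ord = vertex tree

  pos : V → Fin (suc n)
  pos v = proj₁ (tree-spans v)

  ord-pos : ∀ v → ord (pos v) ≡ v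
  ord-pos v = proj₂ (tree-spans v)

  pos-ord : ∀ i → pos (ord i) ≡ i
  pos-ord i = vertex-inj tree _ _ (ord-pos (ord i))

  idx : V → ℕ
  idx v = toℕ (pos v)

  idx-ord : ∀ i → idx (ord i) ≡ toℕ i
  idx-ord i = cong toℕ (pos-ord i)

  idx-inj : ∀ v w → idx v ≡ idx w → v ≡ w
  idx-inj v w eq = trans (≡.sym (ord-pos v)) (trans (cong ord (toℕ-injective eq)) (ord-pos w))

  idx≤n : ∀ v → idx v ≤ n
  idx≤n v = toℕ≤pred[n] (pos v)

  ρ : V
  ρ = ord (fromℕ n)

  idx-ρ : idx ρ ≡ n
  idx-ρ = trans (idx-ord (fromℕ n)) (toℕ-fromℕ n)

  parent-of : V → V
  parent-of v = ord (parent tree (pos v))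

  parent-of-ok : ∀ v → idx v < n → idx v < idx (parent-of v) × adj G v (parent-of v) ≡ true
  parent-of-ok v lt with parent-ok tree (pos v) lt
  ... | later , adjacent =
    subst (toℕ (pos v) <_) (≡.sym (idx-ord _)) later , subst (λ z → adj G z (parent-of v) ≡ true) (ord-pos v) adjacent

  fuel-parent : ∀ f v → idx v < n → n ≤ suc f + idx v → n ≤ f + idx (parent-of v)
  fuel-parent f v lt enough =
    ≤-trans enough (subst (_≤ f + idx (parent-of v)) (+-suc f (idx v)) (+-monoʳ-≤ f (proj₁ (parent-of-ok v lt))))

module Edges {n : ℕ} (G : Graph (suc n)) (connected : Connected G) where

  open import Data.Bool using (Bool; true; false; _∧_)
  open import Data.Bool.Properties using (∧-conicalˡ; ∧-conicalʳ; ∨-zeroʳ)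
  import Data.Bool.Properties as Boolₚ
  open import Data.Nat using (_<_; _*_)
  open import Data.Nat.Properties using (<-irrefl; <-trans; <-asym; <-cmp; <-irrelevant; _<?_)
  open import Data.Fin using (Fin; toℕ; _≟_; combine; remQuot)
  open import Data.Fin.Properties using (toℕ-injective; any?; remQuot-combine; combine-remQuot)
  open import Data.Product using (Σ; _×_; _,_; proj₁; proj₂; uncurry)
  open import Data.Sum using (_⊎_; inj₁; inj₂)
  open import Data.Empty using (⊥-elim)
  open import Relation.Nullary using (¬_; Dec; yes; no)
  open import Relation.Nullary.Decidable using (⌊_⌋; _×-dec_; _⊎-dec_; ¬?)
  open import Relation.Binary.Definitions using (tri<; tri≈; tri>)
  open import Relation.Binary.PropositionalEquality using (_≡_; _≢_; refl; cong; subst; trans)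
  import Relation.Binary.PropositionalEquality as ≡
  open import Axiom.UniquenessOfIdentityProofs using (module Decidable⇒UIP)
  open Basics
  open Enumerations using (Enumeration; enumerate)
  open SpanningTree G connected public

  SamePair : V → V → V → V → Set
  SamePair a b i j = (a ≡ i × b ≡ j) ⊎ (a ≡ j × b ≡ i)

  pair-swap : ∀ {a b} → SamePair a b b a
  pair-swap = inj₂ (refl , refl)

  pair-sym : ∀ {a b i j} → SamePair a b i j → SamePair i j a b
  pair-sym (inj₁ (refl , refl)) = inj₁ (refl , refl)
  pair-sym (inj₂ (refl , refl)) = inj₂ (refl , refl)

  pair-trans : ∀ {a b c d i j} → SamePair a b c d → SamePair c d i j → SamePair a b i j
  pair-trans (inj₁ (refl , refl)) q                    = q
  pair-trans (inj₂ (refl , refl)) (inj₁ (refl , refl)) = inj₂ (refl , refl)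
  pair-trans (inj₂ (refl , refl)) (inj₂ (refl , refl)) = inj₁ (refl , refl)

  sameEdge-sound : ∀ a b i j → sameEdge a b i j ≡ true → SamePair a b i j
  sameEdge-sound a b i j eq with ∨-true (⌊ a ≟ i ⌋ ∧ ⌊ b ≟ j ⌋) _ eq
  ... | inj₁ t = inj₁ (isYes-sound (a ≟ i) (∧-conicalˡ _ _ t) , isYes-sound (b ≟ j) (∧-conicalʳ _ _ t))
  ... | inj₂ t = inj₂ (isYes-sound (a ≟ j) (∧-conicalˡ _ _ t) , isYes-sound (b ≟ i) (∧-conicalʳ _ _ t))

  sameEdge-complete : ∀ a b i j → SamePair a b i j → sameEdge a b i j ≡ true
  sameEdge-complete a b i j (inj₁ (p , q)) rewrite isYes-complete (a ≟ i) p | isYes-complete (b ≟ j) q = refl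
  sameEdge-complete a b i j (inj₂ (p , q)) rewrite isYes-complete (a ≟ j) p | isYes-complete (b ≟ i) q = ∨-zeroʳ _

  lo hi : Edge G → V
  lo e = proj₁ (proj₁ e)
  hi e = proj₂ (proj₁ e)

  edgeVec : V → V → EVec G
  edgeVec a b e = sameEdge a b (lo e) (hi e)

  edgeVec-sound : ∀ {a b} e → edgeVec a b e ≡ true → SamePair a b (lo e) (hi e)
  edgeVec-sound {a} {b} e = sameEdge-sound a b (lo e) (hi e)

  edgeVec-self : ∀ e → edgeVec (lo e) (hi e) e ≡ true
  edgeVec-self e = sameEdge-complete (lo e) (hi e) (lo e) (hi e) (inj₁ (refl , refl))

  edgeVec-false : ∀ {a b} e → ¬ SamePair a b (lo e) (hi e) → edgeVec a b e ≡ false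
  edgeVec-false {a} {b} e different with edgeVec a b e in eq
  ... | false = refl
  ... | true  = ⊥-elim (different (edgeVec-sound e eq))

  edgeVec-pair : ∀ {a b a′ b′} → SamePair a b a′ b′ → ∀ e → edgeVec a b e ≡ edgeVec a′ b′ e
  edgeVec-pair {a} {b} {a′} {b′} same e with edgeVec a′ b′ e in eq
  ... | true  = sameEdge-complete a b (lo e) (hi e) (pair-trans same (edgeVec-sound e eq))
  ... | false = edgeVec-false e λ s → true≢false (trans (≡.sym (sameEdge-complete a′ b′ _ _ (pair-trans (pair-sym same) s))) eq)

  -- an edge is determined by its endpoints (adjacency proofs are unique) …
  edge-ext : (e e′ : Edge G) → proj₁ e ≡ proj₁ e′ → e ≡ e′
  edge-ext ((i , j) , l , a) ((.i , .j) , l′ , a′) refl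
    rewrite <-irrelevant l l′ | Decidable⇒UIP.≡-irrelevant Boolₚ._≟_ a a′ = refl

  edge-unique : (e e′ : Edge G) → SamePair (lo e) (hi e) (lo e′) (hi e′) → e ≡ e′
  edge-unique e e′ (inj₁ (refl , refl)) = edge-ext e e′ refl
  edge-unique e e′ (inj₂ (refl , refl)) = ⊥-elim (<-asym (proj₁ (proj₂ e)) (proj₁ (proj₂ e′)))

  edgeVec-edge : ∀ e e′ → edgeVec (lo e) (hi e) e′ ≡ true → e ≡ e′
  edgeVec-edge e e′ t = edge-unique e e′ (edgeVec-sound e′ t)

  adjacent⇒≢ : ∀ {a b} → adj G a b ≡ true → a ≢ b
  adjacent⇒≢ {a} ab refl = true≢false (trans (≡.sym ab) (irrefl G a))

  mkEdge : (a b : V) → adj G a b ≡ true → Edge G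
  mkEdge a b ab with <-cmp (toℕ a) (toℕ b)
  ... | tri< a<b _ _ = (a , b) , a<b , ab
  ... | tri≈ _ a≡b _ = ⊥-elim (adjacent⇒≢ ab (toℕ-injective a≡b))
  ... | tri> _ _ b<a = (b , a) , b<a , trans (Graph.sym G b a) ab

  mkEdge-pair : ∀ a b ab → SamePair a b (lo (mkEdge a b ab)) (hi (mkEdge a b ab))
  mkEdge-pair a b ab with <-cmp (toℕ a) (toℕ b)
  ... | tri< _ _ _   = inj₁ (refl , refl)
  ... | tri≈ _ a≡b _ = ⊥-elim (adjacent⇒≢ ab (toℕ-injective a≡b))
  ... | tri> _ _ _   = inj₂ (refl , refl)

  mkEdge-unique : ∀ a b ab e → SamePair a b (lo e) (hi e) → mkEdge a b ab ≡ e
  mkEdge-unique a b ab e same = edge-unique _ e (pair-trans (pair-sym (mkEdge-pair a b ab)) same)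

  treeEdge : (c : V) → idx c < n → Edge G
  treeEdge c l = mkEdge c (parent-of c) (proj₂ (parent-of-ok c l))

  treeEdge-pair : ∀ c l → SamePair c (parent-of c) (lo (treeEdge c l)) (hi (treeEdge c l))
  treeEdge-pair c l = mkEdge-pair c (parent-of c) _

  IsTreePair : V → V → Set
  IsTreePair a b = Σ V λ c → idx c < n × SamePair a b c (parent-of c)

  isTreePair? : ∀ a b → Dec (IsTreePair a b)
  isTreePair? a b = any? λ c →
    (idx c <? n) ×-dec (((a ≟ c) ×-dec (b ≟ parent-of c)) ⊎-dec ((a ≟ parent-of c) ×-dec (b ≟ c)))

  -- distinct non-root vertices have distinct tree edges: the parent is later
  treePair-unique : ∀ c c′ → idx c < n → idx c′ < n → SamePair c (parent-of c) c′ (parent-of c′) → c ≡ c′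
  treePair-unique c c′ l l′ (inj₁ (c≡c′ , _)) = c≡c′
  treePair-unique c c′ l l′ (inj₂ (c≡pc′ , pc≡c′)) = ⊥-elim (<-irrefl refl (<-trans
    (subst (λ z → idx c < idx z) pc≡c′ (proj₁ (parent-of-ok c l)))
    (subst (λ z → idx c′ < idx z) (≡.sym c≡pc′) (proj₁ (parent-of-ok c′ l′)))))

  -- the non-tree edges, enumerated through the codes  combine i j  of pairs (i , j)
  decodePair : Fin (suc n * suc n) → V × V
  decodePair = remQuot {suc n} (suc n)

  NonTreePair : V → V → Set
  NonTreePair i j = toℕ i < toℕ j × adj G i j ≡ true × ¬ IsTreePair i j

  NonTreeCode : Fin (suc n * suc n) → Set
  NonTreeCode x = uncurry NonTreePair (decodePair x)

  -- (abstract, so that type checking never unfolds the enumeration)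
  abstract
    nonTreeCodes : Enumeration (suc n * suc n) NonTreeCode
    nonTreeCodes = enumerate NonTreeCode λ x →
      (_ <? _) ×-dec ((adj G _ _ Boolₚ.≟ true) ×-dec ¬? (isTreePair? _ _))

  -- r = |E(G)| − n, the number of non-tree edges
  r : ℕ
  r = Enumeration.size nonTreeCodes

  nonTree : Fin r → Edge G
  nonTree k = decodePair (Enumeration.elem nonTreeCodes k) ,
              proj₁ (Enumeration.elem-P nonTreeCodes k) , proj₁ (proj₂ (Enumeration.elem-P nonTreeCodes k))

  nonTree-not-tree : ∀ k → ¬ IsTreePair (lo (nonTree k)) (hi (nonTree k))
  nonTree-not-tree k = proj₂ (proj₂ (Enumeration.elem-P nonTreeCodes k))

  nonTree-inj : ∀ k k′ → nonTree k ≡ nonTree k′ → k ≡ k′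
  nonTree-inj k k′ eq = Enumeration.elem-inj nonTreeCodes k k′ (begin
    elem k                                   ≡⟨ combine-remQuot {suc n} (suc n) (elem k) ⟨
    uncurry combine (decodePair (elem k))    ≡⟨ cong (λ e → uncurry combine (proj₁ e)) eq ⟩
    uncurry combine (decodePair (elem k′))   ≡⟨ combine-remQuot {suc n} (suc n) (elem k′) ⟩
    elem k′                                  ∎)
    where
    open ≡.≡-Reasoning
    open Enumeration nonTreeCodes using (elem)

  classify : (e : Edge G) → (Σ V λ c → Σ (idx c < n) λ l → treeEdge c l ≡ e) ⊎ (Σ (Fin r) λ k → nonTree k ≡ e)
  classify e@((i , j) , i<j , ij) with isTreePair? i j
  ... | yes (c , l , same) = inj₁ (c , l , mkEdge-unique c (parent-of c) _ e (pair-sym same))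
  ... | no  not-tree with Enumeration.complete nonTreeCodes (combine i j)
                           (subst (uncurry NonTreePair) (≡.sym (remQuot-combine i j)) (i<j , ij , not-tree))
  ...   | k , elem≡ = inj₂ (k , edge-ext _ e (trans (cong decodePair elem≡) (remQuot-combine i j)))

  treeVec-tree : ∀ c l c′ l′ → edgeVec c (parent-of c) (treeEdge c′ l′) ≡ true → c ≡ c′
  treeVec-tree c l c′ l′ t =
    treePair-unique c c′ l l′ (pair-trans (edgeVec-sound (treeEdge c′ l′) t) (pair-sym (treeEdge-pair c′ l′)))

  treeVec-nonTree : ∀ c (l : idx c < n) k → edgeVec c (parent-of c) (nonTree k) ≡ false
  treeVec-nonTree c l k = edgeVec-false (nonTree k) λ same → nonTree-not-tree k (c , l , pair-sym same)

  nonTreeVec-tree : ∀ k c l → edgeVec (lo (nonTree k)) (hi (nonTree k)) (treeEdge c l) ≡ false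
  nonTreeVec-tree k c l = edgeVec-false (treeEdge c l) λ same →
    nonTree-not-tree k (c , l , pair-trans same (pair-sym (treeEdge-pair c l)))

  nonTreeVec-nonTree : ∀ k k′ → edgeVec (lo (nonTree k)) (hi (nonTree k)) (nonTree k′) ≡ true → k ≡ k′
  nonTreeVec-nonTree k k′ t = nonTree-inj k k′ (edgeVec-edge (nonTree k) (nonTree k′) t)

-- A closed walk is handled in two
-- forms: as a list  x ∷ xs  (visiting x, xs, and returning to x), which is
-- convenient for cutting it into pieces, and as a cyclically indexed family
-- Fin (k+1) → V, which is the form of holes.  Both give the same F₂-sum of
-- the indicator vectors of the traversed edges.
module ClosedWalks {n : ℕ} (G : Graph (suc n)) (connected : Connected G) where

  open import Data.Bool using (true; false; _xor_)
  open import Data.Bool.Properties using (xor-assoc; xor-comm)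
  open import Data.Nat using (_<_)
  open import Data.Nat.Properties using (suc-injective; <⇒≤)
  open import Data.Fin using (Fin; zero; suc; toℕ)
  open import Data.List using (List; []; _∷_; _++_; [_]; length; lookup; tabulate)
  open import Data.List.Properties using (++-assoc; ++-identityʳ; tabulate-cong)
  open import Data.List.Relation.Unary.All using (All; []; _∷_)
  import Data.List.Relation.Unary.All.Properties as All
  open import Data.Product using (Σ; _×_; _,_; proj₁; proj₂)
  open import Data.Sum using (inj₁; inj₂)
  open import Data.Empty using (⊥-elim)
  open import Relation.Binary.PropositionalEquality using (_≡_; refl; cong; subst; trans)
  import Relation.Binary.PropositionalEquality as ≡
  open ≡.≡-Reasoning
  open F₂
  open CyclicIndex
  open Edges G connected public

  steps : List V → List (V × V)
  steps []           = []
  steps (x ∷ [])     = []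
  steps (x ∷ y ∷ ys) = (x , y) ∷ steps (y ∷ ys)

  closedSteps : List V → List (V × V)
  closedSteps []       = []
  closedSteps (x ∷ xs) = steps (x ∷ (xs ++ [ x ]))

  pathVec : List (V × V) → EVec G
  pathVec []            e = false
  pathVec ((a , b) ∷ ps) e = edgeVec a b e xor pathVec ps e

  AllAdjacent : List (V × V) → Set
  AllAdjacent = All λ p → adj G (proj₁ p) (proj₂ p) ≡ true

  IsClosedWalk : List V → Set
  IsClosedWalk ws = AllAdjacent (closedSteps ws)

  pathVec-++ : ∀ ps qs e → pathVec (ps ++ qs) e ≡ pathVec ps e xor pathVec qs e
  pathVec-++ []             qs e = refl
  pathVec-++ ((a , b) ∷ ps) qs e rewrite pathVec-++ ps qs e = ≡.sym (xor-assoc (edgeVec a b e) (pathVec ps e) (pathVec qs e))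

  steps-split : ∀ xs y ys → steps (xs ++ y ∷ ys) ≡ steps (xs ++ [ y ]) ++ steps (y ∷ ys)
  steps-split []            y ys = refl
  steps-split (x ∷ [])      y ys = refl
  steps-split (x ∷ x′ ∷ xs) y ys = cong ((x , x′) ∷_) (steps-split (x′ ∷ xs) y ys)

  closedSteps-split : ∀ a A b B → closedSteps (a ∷ A ++ b ∷ B) ≡ steps (a ∷ A ++ [ b ]) ++ steps (b ∷ B ++ [ a ])
  closedSteps-split a A b B = trans (cong (λ z → steps (a ∷ z)) (++-assoc A (b ∷ B) [ a ])) (steps-split (a ∷ A) b (B ++ [ a ]))

  rotate-vec : ∀ A b B e → pathVec (closedSteps (A ++ b ∷ B)) e ≡ pathVec (closedSteps (b ∷ B ++ A)) e
  rotate-vec []      b B e rewrite ++-identityʳ B = refl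
  rotate-vec (a ∷ A) b B e
    rewrite closedSteps-split a A b B | closedSteps-split b B a A
          | pathVec-++ (steps (a ∷ A ++ [ b ])) (steps (b ∷ B ++ [ a ])) e
          | pathVec-++ (steps (b ∷ B ++ [ a ])) (steps (a ∷ A ++ [ b ])) e
    = xor-comm (pathVec (steps (a ∷ A ++ [ b ])) e) (pathVec (steps (b ∷ B ++ [ a ])) e)

  rotate-walk : ∀ A b B → IsClosedWalk (A ++ b ∷ B) → IsClosedWalk (b ∷ B ++ A)
  rotate-walk []      b B w rewrite ++-identityʳ B = w
  rotate-walk (a ∷ A) b B w rewrite closedSteps-split a A b B | closedSteps-split b B a A
    with All.++⁻ (steps (a ∷ A ++ [ b ])) w
  ... | first , second = All.++⁺ second first

  split-at : ∀ (ws : List V) (t : Fin (length ws)) →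
    Σ (List V) λ B → Σ (List V) λ C → (ws ≡ B ++ lookup ws t ∷ C) × (length B ≡ toℕ t)
  split-at (x ∷ xs) zero    = [] , xs , refl , refl
  split-at (x ∷ xs) (suc t) with split-at xs t
  ... | B , C , eq , len = x ∷ B , C , cong (x ∷_) eq , cong suc len

  split-at₂ : ∀ (ws : List V) (s t : Fin (length ws)) → toℕ s < toℕ t →
    Σ (List V) λ A → Σ (List V) λ B → Σ (List V) λ C →
      (ws ≡ A ++ lookup ws s ∷ B ++ lookup ws t ∷ C) × (length A ≡ toℕ s) × (suc (length A + length B) ≡ toℕ t)
  split-at₂ (x ∷ xs) zero    (suc t) _ with split-at xs t
  ... | B , C , eq , len = [] , B , C , cong (x ∷_) eq , refl , cong suc len
  split-at₂ (x ∷ xs) (suc s) (suc t) (s≤s s<t) with split-at₂ xs s t s<t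
  ... | A , B , C , eq , len₁ , len₂ = x ∷ A , B , C , cong (x ∷_) eq , cong suc len₁ , cong suc len₂

  record CyclicWalk : Set where
    field
      k        : ℕ
      at       : Fin (suc k) → V
      adjacent : ∀ t → adj G (at t) (at (next t)) ≡ true

  cycleVec : CyclicWalk → EVec G
  cycleVec C e = ∑[ t < suc k ] edgeVec (at t) (at (next t)) e
    where open CyclicWalk C

  -- every hole is a cyclic walk, and χ_C is its edge vector: two steps of a
  -- hole on the same edge are equal (a reversed repetition would force
  -- next (next t) = t), so the disjunction in χ is a sum
  holeWalk : Hole G → CyclicWalk
  holeWalk C = record { k = len-1 C ; at = vtx C ; adjacent = Hole.consec C }

  χ≡cycleVec : ∀ (C : Hole G) e → χ C e ≡ cycleVec (holeWalk C) e
  χ≡cycleVec C e = anyFin≡sum _ once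
    where
    once : ∀ s t → edgeVec (vtx C s) (vtx C (next s)) e ≡ true → edgeVec (vtx C t) (vtx C (next t)) e ≡ true → s ≡ t
    once s t es et with pair-trans (edgeVec-sound e es) (pair-sym (edgeVec-sound e et))
    ... | inj₁ (same , _) = inj C s t same
    ... | inj₂ (s≡nt , ns≡t) = ⊥-elim (next-next≢ (<⇒≤ (long C)) t (begin
      next (next t)  ≡⟨ cong next (inj C s (next t) s≡nt) ⟨
      next s         ≡⟨ inj C (next s) t ns≡t ⟩
      t              ∎))

  after : (ys : List V) → V → Fin (length ys) → V
  after (y ∷ [])      z zero    = z
  after (y ∷ y′ ∷ ys) z zero    = y′
  after (y ∷ y′ ∷ ys) z (suc t) = after (y′ ∷ ys) z t

  steps-tabulate : ∀ y ys z → steps (y ∷ (ys ++ [ z ])) ≡ tabulate (λ t → lookup (y ∷ ys) t , after (y ∷ ys) z t)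
  steps-tabulate y []        z = refl
  steps-tabulate y (y′ ∷ ys) z = cong ((y , y′) ∷_) (steps-tabulate y′ ys z)

  after-inner : ∀ ys z (t u : Fin (length ys)) → toℕ u ≡ suc (toℕ t) → after ys z t ≡ lookup ys u
  after-inner (y ∷ y′ ∷ ys) z zero    (suc zero) _  = refl
  after-inner (y ∷ y′ ∷ ys) z (suc t) (suc u)    eq = after-inner (y′ ∷ ys) z t u (suc-injective eq)

  after-last : ∀ ys z (t : Fin (length ys)) → suc (toℕ t) ≡ length ys → after ys z t ≡ z
  after-last (y ∷ [])      z zero    _  = refl
  after-last (y ∷ y′ ∷ ys) z (suc t) eq = after-last (y′ ∷ ys) z t (suc-injective eq)

  after-next : ∀ x xs (t : Fin (suc (length xs))) → after (x ∷ xs) x t ≡ lookup (x ∷ xs) (next t)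
  after-next x xs t with next-cases t
  ... | inj₁ (_ , forward) = after-inner (x ∷ xs) x t (next t) forward
  ... | inj₂ (last , wrap) = trans (after-last (x ∷ xs) x t (cong suc last)) (cong (lookup (x ∷ xs)) (≡.sym wrap))

  closedSteps-tabulate : ∀ x xs → closedSteps (x ∷ xs) ≡ tabulate (λ t → lookup (x ∷ xs) t , lookup (x ∷ xs) (next t))
  closedSteps-tabulate x xs = trans (steps-tabulate x xs x) (tabulate-cong λ t → cong (lookup (x ∷ xs) t ,_) (after-next x xs t))

  pathVec-tabulate : ∀ {m} (f : Fin m → V × V) e → pathVec (tabulate f) e ≡ ∑[ t < m ] edgeVec (proj₁ (f t)) (proj₂ (f t)) e
  pathVec-tabulate {zero}  f e = refl
  pathVec-tabulate {suc m} f e = cong (edgeVec (proj₁ (f zero)) (proj₂ (f zero)) e xor_) (pathVec-tabulate (λ t → f (suc t)) e)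

  listWalk : (x : V) (xs : List V) → IsClosedWalk (x ∷ xs) → CyclicWalk
  listWalk x xs w = record
    { k = length xs ; at = lookup (x ∷ xs)
    ; adjacent = All.tabulate⁻ (subst AllAdjacent (closedSteps-tabulate x xs) w) }

  listWalk-vec : ∀ x xs w e → cycleVec (listWalk x xs w) e ≡ pathVec (closedSteps (x ∷ xs)) e
  listWalk-vec x xs w e = ≡.sym (begin
    pathVec (closedSteps (x ∷ xs)) e   ≡⟨ cong (λ ps → pathVec ps e) (closedSteps-tabulate x xs) ⟩
    pathVec (tabulate stepAt) e        ≡⟨ pathVec-tabulate stepAt e ⟩
    cycleVec (listWalk x xs w) e       ∎)
    where
    stepAt : Fin (suc (length xs)) → V × V
    stepAt t = lookup (x ∷ xs) t , lookup (x ∷ xs) (next t)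

-- By induction on the length: a closed walk of length 2 has
-- vector 0, one of length 3 would be a triangle, and one of length ≥ 4 is
-- either a hole, or it repeats a vertex, or it has a chord; in the last two
-- cases it is the F₂-sum of two shorter closed walks.
module HoleSpan {n : ℕ} (G : Graph (suc n)) (connected : Connected G) (triangle-free : TriangleFree G) where

  open import Data.Bool using (true; false; _xor_)
  open import Data.Bool.Properties using (xor-assoc; xor-identityʳ; xor-same)
  import Data.Bool.Properties as Boolₚ
  open import Data.Nat using (_<_; z≤n)
  open import Data.Nat.Properties
    using (suc-injective; +-comm; +-identityʳ; +-monoʳ-≤; +-monoˡ-≤; m≤m+n; m≤n+m; <-≤-trans; ≤-trans; ≤-refl)
  open import Data.Nat.Solver using (module +-*-Solver)
  open import Data.Fin using (Fin; zero; suc; toℕ; _≟_)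
  open import Data.Fin.Properties using (toℕ-injective; toℕ≤pred[n]; all?)
  open import Data.List using (List; []; _∷_; _++_; [_]; length; lookup; map; foldr)
  open import Data.List.Properties using (++-assoc; length-++)
  open import Data.List.Relation.Unary.All using (All; []; _∷_)
  import Data.List.Relation.Unary.All.Properties as All
  open import Data.Product using (Σ; _×_; _,_; proj₁; proj₂)
  open import Data.Sum using (_⊎_; inj₁; inj₂)
  open import Data.Empty using (⊥-elim)
  open import Relation.Nullary using (¬_; Dec; yes; no)
  open import Relation.Nullary.Decidable using (_→-dec_; _⊎-dec_)
  open import Relation.Binary.PropositionalEquality using (_≡_; _≢_; refl; cong; cong₂; subst; subst₂; trans)
  import Relation.Binary.PropositionalEquality as ≡
  open ≡.≡-Reasoning
  open Basics
  open ClosedWalks G connected public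
  open CyclicIndex

  InH : EVec G → Set
  InH = InHoleSpace G

  InH-ext : ∀ {v w : EVec G} → (∀ e → v e ≡ w e) → InH w → InH v
  InH-ext v≗w (L , w≡) = L , λ e → trans (v≗w e) (w≡ e)

  InH-zero : InH (λ _ → false)
  InH-zero = [] , λ _ → refl

  InH-hole : (C : Hole G) → InH (χ C)
  InH-hole C = C ∷ [] , λ e → ≡.sym (xor-identityʳ (χ C e))

  InH-xor : ∀ {v w : EVec G} → InH v → InH w → InH (λ e → v e xor w e)
  InH-xor (L₁ , v≡) (L₂ , w≡) = L₁ ++ L₂ , λ e → trans (cong₂ _xor_ (v≡ e) (w≡ e)) (≡.sym (sum-++ L₁ L₂ e))
    where
    sum-++ : ∀ L₁ L₂ e → foldr _xor_ false (map (λ C → χ C e) (L₁ ++ L₂)) ≡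
                         foldr _xor_ false (map (λ C → χ C e) L₁) xor foldr _xor_ false (map (λ C → χ C e) L₂)
    sum-++ []       L₂ e = refl
    sum-++ (C ∷ L₁) L₂ e rewrite sum-++ L₁ L₂ e = ≡.sym (xor-assoc (χ C e) _ _)

  WalkInH : List V → Set
  WalkInH ws = InH (pathVec (closedSteps ws))

  repeat-split : ∀ (A : List V) a B C → IsClosedWalk (A ++ a ∷ B ++ a ∷ C) →
    IsClosedWalk (a ∷ B) × IsClosedWalk (a ∷ (C ++ A)) ×
    (∀ e → pathVec (closedSteps (A ++ a ∷ B ++ a ∷ C)) e ≡
           pathVec (closedSteps (a ∷ B)) e xor pathVec (closedSteps (a ∷ (C ++ A))) e)
  repeat-split A a B C w = proj₁ pieces , proj₂ pieces , vec
    where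
    rotated : (B ++ a ∷ C) ++ A ≡ B ++ a ∷ (C ++ A)
    rotated = ++-assoc B (a ∷ C) A
    split : closedSteps (a ∷ (B ++ a ∷ C) ++ A) ≡ closedSteps (a ∷ B) ++ closedSteps (a ∷ (C ++ A))
    split = trans (cong (λ z → closedSteps (a ∷ z)) rotated) (closedSteps-split a B a (C ++ A))
    pieces : IsClosedWalk (a ∷ B) × IsClosedWalk (a ∷ (C ++ A))
    pieces = All.++⁻ (closedSteps (a ∷ B)) (subst AllAdjacent split (rotate-walk A a (B ++ a ∷ C) w))
    vec : ∀ e → pathVec (closedSteps (A ++ a ∷ B ++ a ∷ C)) e ≡
                pathVec (closedSteps (a ∷ B)) e xor pathVec (closedSteps (a ∷ (C ++ A))) e
    vec e = begin
      pathVec (closedSteps (A ++ a ∷ B ++ a ∷ C)) e      ≡⟨ rotate-vec A a (B ++ a ∷ C) e ⟩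
      pathVec (closedSteps (a ∷ (B ++ a ∷ C) ++ A)) e    ≡⟨ cong (λ ps → pathVec ps e) split ⟩
      pathVec (closedSteps (a ∷ B) ++ closedSteps (a ∷ (C ++ A))) e
                                                         ≡⟨ pathVec-++ (closedSteps (a ∷ B)) _ e ⟩
      pathVec (closedSteps (a ∷ B)) e xor pathVec (closedSteps (a ∷ (C ++ A))) e ∎

  chord-split : ∀ (A : List V) a B b C → adj G a b ≡ true → IsClosedWalk (A ++ a ∷ B ++ b ∷ C) →
    IsClosedWalk (a ∷ (B ++ [ b ])) × IsClosedWalk (b ∷ ((C ++ A) ++ [ a ])) ×
    (∀ e → pathVec (closedSteps (A ++ a ∷ B ++ b ∷ C)) e ≡
           pathVec (closedSteps (a ∷ (B ++ [ b ]))) e xor pathVec (closedSteps (b ∷ ((C ++ A) ++ [ a ]))) e)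
  chord-split A a B b C ab w = piece₁ , piece₂ , vec
    where
    D : List V
    D = C ++ A
    P₁ P₂ : List (V × V)
    P₁ = steps (a ∷ B ++ [ b ])
    P₂ = steps (b ∷ D ++ [ a ])
    rotated : (B ++ b ∷ C) ++ A ≡ B ++ b ∷ D
    rotated = ++-assoc B (b ∷ C) A
    split : closedSteps (a ∷ (B ++ b ∷ C) ++ A) ≡ P₁ ++ P₂
    split = trans (cong (λ z → closedSteps (a ∷ z)) rotated) (closedSteps-split a B b D)
    halves : AllAdjacent P₁ × AllAdjacent P₂
    halves = All.++⁻ P₁ (subst AllAdjacent split (rotate-walk A a (B ++ b ∷ C) w))
    closed₁ : closedSteps (a ∷ (B ++ [ b ])) ≡ P₁ ++ [ (b , a) ]
    closed₁ = closedSteps-split a B b []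
    closed₂ : closedSteps (b ∷ (D ++ [ a ])) ≡ P₂ ++ [ (a , b) ]
    closed₂ = closedSteps-split b D a []
    piece₁ : IsClosedWalk (a ∷ (B ++ [ b ]))
    piece₁ = subst AllAdjacent (≡.sym closed₁) (All.++⁺ (proj₁ halves) (trans (Graph.sym G b a) ab ∷ []))
    piece₂ : IsClosedWalk (b ∷ (D ++ [ a ]))
    piece₂ = subst AllAdjacent (≡.sym closed₂) (All.++⁺ (proj₂ halves) (ab ∷ []))
    -- the chord is traversed once in each direction and cancels
    cancel : ∀ p q x → (p xor (x xor false)) xor (q xor (x xor false)) ≡ p xor q
    cancel false false false = refl
    cancel false false true  = refl
    cancel false true  false = refl
    cancel false true  true  = refl
    cancel true  false false = refl
    cancel true  false true  = refl
    cancel true  true  false = refl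
    cancel true  true  true  = refl
    vec : ∀ e → pathVec (closedSteps (A ++ a ∷ B ++ b ∷ C)) e ≡
                pathVec (closedSteps (a ∷ (B ++ [ b ]))) e xor pathVec (closedSteps (b ∷ (D ++ [ a ]))) e
    vec e = begin
      pathVec (closedSteps (A ++ a ∷ B ++ b ∷ C)) e      ≡⟨ rotate-vec A a (B ++ b ∷ C) e ⟩
      pathVec (closedSteps (a ∷ (B ++ b ∷ C) ++ A)) e    ≡⟨ cong (λ ps → pathVec ps e) split ⟩
      pathVec (P₁ ++ P₂) e                               ≡⟨ pathVec-++ P₁ P₂ e ⟩
      pathVec P₁ e xor pathVec P₂ e                      ≡⟨ cancel (pathVec P₁ e) (pathVec P₂ e) (edgeVec a b e) ⟨
      (pathVec P₁ e xor (edgeVec a b e xor false)) xor (pathVec P₂ e xor (edgeVec a b e xor false))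
        ≡⟨ cong (λ z → (pathVec P₁ e xor (z xor false)) xor (pathVec P₂ e xor (edgeVec a b e xor false)))
                (edgeVec-pair (pair-swap {a} {b}) e) ⟩
      (pathVec P₁ e xor (edgeVec b a e xor false)) xor (pathVec P₂ e xor (edgeVec a b e xor false))
        ≡⟨ cong₂ _xor_ (pathVec-++ P₁ [ (b , a) ] e) (pathVec-++ P₂ [ (a , b) ] e) ⟨
      pathVec (P₁ ++ [ (b , a) ]) e xor pathVec (P₂ ++ [ (a , b) ]) e
        ≡⟨ cong₂ (λ ps qs → pathVec ps e xor pathVec qs e) closed₁ closed₂ ⟨
      pathVec (closedSteps (a ∷ (B ++ [ b ]))) e xor pathVec (closedSteps (b ∷ (D ++ [ a ]))) e ∎

  adjacent? : ∀ {L} (f : Fin L → V) s t → Dec (adj G (f s) (f t) ≡ true)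
  adjacent? f s t = adj G (f s) (f t) Boolₚ.≟ true

  consecutive? : ∀ {L} (s t : Fin (suc L)) → Dec ((t ≡ next s) ⊎ (s ≡ next t))
  consecutive? s t = (t ≟ next s) ⊎-dec (s ≟ next t)

  Injective Induced : ∀ {L} → (Fin (suc L) → V) → Set
  Injective f = ∀ s t → f s ≡ f t → s ≡ t
  Induced   f = ∀ s t → adj G (f s) (f t) ≡ true → (t ≡ next s) ⊎ (s ≡ next t)

  injective? : ∀ {L} (f : Fin (suc L) → V) → Dec (Injective f)
  injective? f = all? λ s → all? λ t → (f s ≟ f t) →-dec (s ≟ t)

  induced? : ∀ {L} (f : Fin (suc L) → V) → Dec (Induced f)
  induced? f = all? λ s → all? λ t → adjacent? f s t →-dec consecutive? s t

  data Shape {L : ℕ} (f : Fin (suc L) → V) : Set where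
    hole   : Injective f → Induced f → Shape f
    repeat : ∀ s t → toℕ s < toℕ t → f s ≡ f t → Shape f
    chord  : ∀ s t → toℕ s < toℕ t → adj G (f s) (f t) ≡ true → t ≢ next s → s ≢ next t → Shape f

  repetition : ∀ {L} (f : Fin (suc L) → V) → ¬ Injective f → Shape f
  repetition f not-injective with violation (λ s t → f s ≟ f t) (λ s t → s ≟ t) not-injective
  ... | s , t , same , s≢t with ordered s t s≢t
  ...   | inj₁ s<t = repeat s t s<t same
  ...   | inj₂ t<s = repeat t s t<s (≡.sym same)

  chordAt : ∀ {L} (f : Fin (suc L) → V) s t → adj G (f s) (f t) ≡ true → ¬ ((t ≡ next s) ⊎ (s ≡ next t)) →
    toℕ s < toℕ t ⊎ toℕ t < toℕ s → Shape f
  chordAt f s t st not-consecutive (inj₁ s<t) =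
    chord s t s<t st (λ e → not-consecutive (inj₁ e)) (λ e → not-consecutive (inj₂ e))
  chordAt f s t st not-consecutive (inj₂ t<s) =
    chord t s t<s (trans (Graph.sym G (f t) (f s)) st) (λ e → not-consecutive (inj₂ e)) (λ e → not-consecutive (inj₁ e))

  chordOf : ∀ {L} (f : Fin (suc L) → V) → ¬ Induced f → Shape f
  chordOf f not-induced =
    let (s , t , st , not-consecutive) = violation (adjacent? f) consecutive? not-induced
    in  chordAt f s t st not-consecutive (ordered s t (λ s≡t → adjacent⇒≢ st (cong f s≡t)))

  shape : ∀ {L} (f : Fin (suc L) → V) → Shape f
  shape f with injective? f | induced? f
  ... | yes injective | yes induced  = hole injective induced
  ... | no  not-inj   | _            = repetition f not-inj
  ... | yes _         | no  not-ind  = chordOf f not-ind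

  length-split : ∀ (A : List V) a B b C → length (A ++ a ∷ B ++ b ∷ C) ≡ suc (suc (length B + (length C + length A)))
  length-split A a B b C rewrite length-++ A {a ∷ B ++ b ∷ C} | length-++ B {b ∷ C} =
    solve 3 (λ α β γ → α :+ (con 1 :+ (β :+ (con 1 :+ γ))) := con 2 :+ (β :+ (γ :+ α))) refl (length A) (length B) (length C)
    where open +-*-Solver

  piece-< : ∀ {m p q} → m ≡ suc (p + q) → 1 ≤ q → p + 1 < m
  piece-< {p = p} refl 1≤q = s≤s (+-monoʳ-≤ p 1≤q)

  piece-<′ : ∀ {m p q} → m ≡ suc (p + q) → 1 ≤ p → q + 1 < m
  piece-<′ {p = p} {q} refl 1≤p = s≤s (subst (_≤ p + q) (+-comm 1 q) (+-monoˡ-≤ q 1≤p))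

  module LongWalk (x : V) (xs : List V) (long : 3 ≤ length xs) (walk : IsClosedWalk (x ∷ xs))
                  (shorter∈H : ∀ x′ xs′ → length xs′ < length xs → IsClosedWalk (x′ ∷ xs′) → WalkInH (x′ ∷ xs′)) where

    ws : List V
    ws = x ∷ xs

    L : ℕ
    L = length xs

    via-repeat : ∀ s t → toℕ s < toℕ t → lookup ws s ≡ lookup ws t → WalkInH ws
    via-repeat s t s<t same with split-at₂ ws s t s<t
    ... | A , B , C , ws≡ , _ , _ =
      let (w₁ , w₂ , vec) = repeat-split A a B C (subst IsClosedWalk ws≡′ walk)
      in  subst WalkInH (≡.sym ws≡′) (InH-ext vec (InH-xor (shorter∈H a B B<L w₁) (shorter∈H a (C ++ A) CA<L w₂)))
      where
      a : V
      a = lookup ws s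
      ws≡′ : ws ≡ A ++ a ∷ B ++ a ∷ C
      ws≡′ = trans ws≡ (cong (λ z → A ++ a ∷ B ++ z ∷ C) (≡.sym same))
      L≡ : L ≡ suc (length B + (length C + length A))
      L≡ = suc-injective (trans (cong length ws≡′) (length-split A a B a C))
      B<L : length B < L
      B<L = subst (length B <_) (≡.sym L≡) (s≤s (m≤m+n _ _))
      CA<L : length (C ++ A) < L
      CA<L = subst₂ _<_ (≡.sym (length-++ C {A})) (≡.sym L≡) (s≤s (m≤n+m _ (length B)))

    -- a chord is not an edge of the walk, so both arcs it cuts off are nonempty
    inner-arc-nonempty : ∀ (A B : List V) (s t : Fin (suc L)) → toℕ s < toℕ t → length A ≡ toℕ s →
      suc (length A + length B) ≡ toℕ t → t ≢ next s → 1 ≤ length B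
    inner-arc-nonempty A (_ ∷ _) s t _   _     _      _ = s≤s z≤n
    inner-arc-nonempty A []      s t s<t len-A len-AB t≢s+1 = ⊥-elim (t≢s+1 (toℕ-injective (begin
      toℕ t               ≡⟨ len-AB ⟨
      suc (length A + 0)  ≡⟨ cong suc (trans (+-identityʳ _) len-A) ⟩
      suc (toℕ s)         ≡⟨ toℕ-next s (<-≤-trans s<t (toℕ≤pred[n] t)) ⟨
      toℕ (next s)        ∎)))

    outer-arc-nonempty : ∀ (A B C : List V) (s t : Fin (suc L)) → length A ≡ toℕ s → suc (length A + length B) ≡ toℕ t →
      L ≡ suc (length B + (length C + length A)) → s ≢ next t → 1 ≤ length C + length A
    outer-arc-nonempty A       B (_ ∷ _) s t _ _ _ _ = s≤s z≤n
    outer-arc-nonempty (_ ∷ _) B []      s t _ _ _ _ = s≤s z≤n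
    outer-arc-nonempty []      B []      s t len-A len-AB L≡ s≢t+1 = ⊥-elim (s≢t+1 (begin
      s        ≡⟨ toℕ-injective (≡.sym len-A) ⟩
      zero     ≡⟨ next-last t (begin
                    toℕ t              ≡⟨ len-AB ⟨
                    suc (length B)     ≡⟨ cong suc (+-identityʳ (length B)) ⟨
                    suc (length B + 0) ≡⟨ L≡ ⟨
                    L                  ∎) ⟨
      next t   ∎))

    via-chord : ∀ s t → toℕ s < toℕ t → adj G (lookup ws s) (lookup ws t) ≡ true → t ≢ next s → s ≢ next t → WalkInH ws
    via-chord s t s<t ab t≢s+1 s≢t+1 with split-at₂ ws s t s<t
    ... | A , B , C , ws≡ , len-A , len-AB =
      let (w₁ , w₂ , vec) = chord-split A a B b C ab (subst IsClosedWalk ws≡ walk)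
      in  subst WalkInH (≡.sym ws≡)
            (InH-ext vec (InH-xor (shorter∈H a (B ++ [ b ]) piece₁<L w₁) (shorter∈H b ((C ++ A) ++ [ a ]) piece₂<L w₂)))
      where
      a b : V
      a = lookup ws s
      b = lookup ws t
      L≡ : L ≡ suc (length B + (length C + length A))
      L≡ = suc-injective (trans (cong length ws≡) (length-split A a B b C))
      piece₁<L : length (B ++ [ b ]) < L
      piece₁<L = subst (_< L) (≡.sym (length-++ B {[ b ]})) (piece-< L≡ (outer-arc-nonempty A B C s t len-A len-AB L≡ s≢t+1))
      piece₂<L : length ((C ++ A) ++ [ a ]) < L
      piece₂<L = subst (_< L) (≡.sym (trans (length-++ (C ++ A) {[ a ]}) (cong (_+ 1) (length-++ C {A}))))
                   (piece-<′ L≡ (inner-arc-nonempty A B s t s<t len-A len-AB t≢s+1))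

    walk∈H : WalkInH ws
    walk∈H with shape (lookup ws)
    ... | repeat s t s<t same = via-repeat s t s<t same
    ... | chord s t s<t ab t≢s+1 s≢t+1 = via-chord s t s<t ab t≢s+1 s≢t+1
    ... | hole injective induced = InH-ext (λ e → ≡.sym (trans (χ≡cycleVec H e) (listWalk-vec x xs walk e))) (InH-hole H)
      where
      H : Hole G
      H = record { len-1 = L ; long = long ; vtx = lookup ws ; inj = injective
                 ; consec = CyclicWalk.adjacent (listWalk x xs walk) ; induced = induced }

  closedWalk∈H′ : ∀ bound x xs → length xs < bound → IsClosedWalk (x ∷ xs) → WalkInH (x ∷ xs)
  closedWalk∈H′ (suc bound) x []           _ (xx ∷ []) = ⊥-elim (adjacent⇒≢ xx refl)
  closedWalk∈H′ (suc bound) x (y ∷ [])     _ _         = InH-ext there-and-back InH-zero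
    where
    there-and-back : ∀ e → edgeVec x y e xor (edgeVec y x e xor false) ≡ false
    there-and-back e = begin
      edgeVec x y e xor (edgeVec y x e xor false) ≡⟨ cong (edgeVec x y e xor_) (xor-identityʳ (edgeVec y x e)) ⟩
      edgeVec x y e xor edgeVec y x e             ≡⟨ cong (edgeVec x y e xor_) (edgeVec-pair (pair-swap {y} {x}) e) ⟩
      edgeVec x y e xor edgeVec x y e             ≡⟨ xor-same (edgeVec x y e) ⟩
      false                                       ∎
  closedWalk∈H′ (suc bound) x (y ∷ z ∷ []) _ (xy ∷ yz ∷ zx ∷ []) =
    ⊥-elim (triangle-free x y z xy yz (trans (Graph.sym G x z) zx))
  closedWalk∈H′ (suc bound) x xs@(_ ∷ _ ∷ _ ∷ _) (s≤s len<bound) w =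
    LongWalk.walk∈H x xs (s≤s (s≤s (s≤s z≤n))) w λ x′ xs′ shorter → closedWalk∈H′ bound x′ xs′ (≤-trans shorter len<bound)

  closedWalk∈H : ∀ x xs → IsClosedWalk (x ∷ xs) → WalkInH (x ∷ xs)
  closedWalk∈H x xs = closedWalk∈H′ (suc (length xs)) x xs ≤-refl

-- Removing the tree edge
-- {c, parent c} splits the vertices into the subtree below c and the rest;
-- a closed walk crosses this cut an even number of times, so the coordinate
-- of its edge vector at the tree edge is determined by its coordinates at
-- the non-tree edges crossing the cut.  The equations are linear, hence
-- they hold on the whole hole space.
module CutEquations {n : ℕ} (G : Graph (suc n)) (connected : Connected G) where

  open import Data.Bool using (Bool; true; false; _∧_; _∨_; _xor_)
  open import Data.Bool.Properties using (xor-same; xor-comm; xor-identityʳ; ∧-zeroʳ; ∧-identityʳ; ∧-distribˡ-xor)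
  open import Data.Nat using (_<_; z≤n)
  open import Data.Nat.Properties using (_<?_; <-irrefl; ≤-antisym; <-≤-trans; <⇒≤; ≤-refl; m≤m+n; n≤1+n)
  open import Data.Fin using (Fin; zero; suc; _≟_)
  open import Data.List using ([]; _∷_; map; foldr)
  open import Data.Product using (_,_; proj₁)
  open import Data.Sum using (inj₁; inj₂)
  open import Data.Empty using (⊥-elim)
  open import Relation.Nullary using (yes; no)
  open import Relation.Nullary.Decidable using (⌊_⌋)
  open import Relation.Binary.PropositionalEquality using (_≡_; _≢_; refl; cong; cong₂; subst; trans)
  import Relation.Binary.PropositionalEquality as ≡
  open ≡.≡-Reasoning
  open F₂
  open CyclicIndex
  open ClosedWalks G connected

  root-of : ∀ v → n ≤ idx v → v ≡ ρ
  root-of v n≤idx = idx-inj v ρ (trans (≤-antisym (idx≤n v) n≤idx) (≡.sym idx-ρ))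

  -- belowF f c v: c lies on the tree path from v towards the root, found
  -- within f steps (n steps always suffice, as each step increases the index)
  belowF : ℕ → V → V → Bool
  belowF zero    c v = ⌊ v ≟ c ⌋
  belowF (suc f) c v with idx v <? n
  ... | yes _ = ⌊ v ≟ c ⌋ ∨ belowF f c (parent-of v)
  ... | no  _ = ⌊ v ≟ c ⌋

  belowF-idx : ∀ f c v → belowF f c v ≡ true → idx v ≤ idx c
  belowF-idx zero c v t with v ≟ c
  ... | yes refl = ≤-refl
  belowF-idx (suc f) c v t with idx v <? n
  ... | no _ with v ≟ c
  ...   | yes refl = ≤-refl
  belowF-idx (suc f) c v t | yes lt with v ≟ c
  ...   | yes refl = ≤-refl
  ...   | no  _    = <⇒≤ (<-≤-trans (proj₁ (parent-of-ok v lt)) (belowF-idx f c (parent-of v) t))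

  belowF-fuel : ∀ f f′ c v → n ≤ f + idx v → f ≤ f′ → belowF f c v ≡ belowF f′ c v
  belowF-fuel zero    zero     c v _      _ = refl
  belowF-fuel zero    (suc f′) c v enough _ with idx v <? n
  ... | yes lt = ⊥-elim (<-irrefl refl (<-≤-trans lt enough))
  ... | no  _  = refl
  belowF-fuel (suc f) (suc f′) c v enough (s≤s f≤f′) with idx v <? n
  ... | no  _  = refl
  ... | yes lt = cong (⌊ v ≟ c ⌋ ∨_) (belowF-fuel f f′ c (parent-of v) (fuel-parent f v lt enough) f≤f′)

  below : V → V → Bool
  below c v = belowF n c v

  below-unfold : ∀ c v → idx v < n → below c v ≡ ⌊ v ≟ c ⌋ ∨ below c (parent-of v)
  below-unfold c v lt = unfold n refl
    where
    unfold : ∀ m → m ≡ n → belowF m c v ≡ ⌊ v ≟ c ⌋ ∨ belowF n c (parent-of v)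
    unfold zero    m≡n = ⊥-elim (<-irrefl refl (<-≤-trans lt (subst (_≤ idx v) m≡n z≤n)))
    unfold (suc m) m≡n with idx v <? n
    ... | no  ¬lt = ⊥-elim (¬lt lt)
    ... | yes _   = cong (⌊ v ≟ c ⌋ ∨_) (belowF-fuel m n c (parent-of v)
                      (fuel-parent m v lt (subst (_≤ suc m + idx v) m≡n (m≤m+n (suc m) (idx v))))
                      (subst (m ≤_) m≡n (n≤1+n m)))

  below-parent : ∀ c v → idx v < n → below c v xor below c (parent-of v) ≡ ⌊ v ≟ c ⌋
  below-parent c v lt rewrite below-unfold c v lt with v ≟ c
  ... | no  _    = xor-same (below c (parent-of v))
  ... | yes refl with below c (parent-of c) in above
  ...   | false = refl
  ...   | true  = ⊥-elim (<-irrefl refl (<-≤-trans (proj₁ (parent-of-ok c lt)) (belowF-idx n c (parent-of c) above)))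

  below-pair : ∀ {a b a′ b′} c → SamePair a b a′ b′ → below c a xor below c b ≡ below c a′ xor below c b′
  below-pair c (inj₁ (refl , refl))          = refl
  below-pair {a} {b} c (inj₂ (refl , refl)) = xor-comm (below c a) (below c b)

  crosses : V → Fin r → Bool
  crosses c k = below c (lo (nonTree k)) xor below c (hi (nonTree k))

  CutEquations : EVec G → Set
  CutEquations v = ∀ c (l : idx c < n) → v (treeEdge c l) ≡ ∑[ k < r ] (crosses c k ∧ v (nonTree k))

  step-balance : ∀ c (l : idx c < n) a b → adj G a b ≡ true →
    edgeVec a b (treeEdge c l) xor ∑[ k < r ] (crosses c k ∧ edgeVec a b (nonTree k)) ≡ below c a xor below c b
  step-balance c l a b ab with classify (mkEdge a b ab)
  ... | inj₁ (c′ , l′ , eq) = begin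
    edgeVec a b (treeEdge c l) xor ∑[ k < r ] (crosses c k ∧ edgeVec a b (nonTree k))
      ≡⟨ cong₂ _xor_ tree-coordinate (sum-zero _ λ k → trans (cong (crosses c k ∧_) (nonTree-coordinate k)) (∧-zeroʳ _)) ⟩
    ⌊ c′ ≟ c ⌋ xor false                ≡⟨ xor-identityʳ _ ⟩
    ⌊ c′ ≟ c ⌋                          ≡⟨ below-parent c c′ l′ ⟨
    below c c′ xor below c (parent-of c′) ≡⟨ below-pair c same ⟨
    below c a xor below c b             ∎
    where
    same : SamePair a b c′ (parent-of c′)
    same = pair-trans (mkEdge-pair a b ab)
             (pair-sym (subst (λ z → SamePair c′ (parent-of c′) (lo z) (hi z)) eq (treeEdge-pair c′ l′)))
    tree-coordinate : edgeVec a b (treeEdge c l) ≡ ⌊ c′ ≟ c ⌋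
    tree-coordinate with c′ ≟ c
    ... | yes refl = trans (edgeVec-pair same (treeEdge c l)) (sameEdge-complete _ _ _ _ (treeEdge-pair c l))
    ... | no  c′≢c with edgeVec a b (treeEdge c l) in at-c
    ...   | false = refl
    ...   | true  = ⊥-elim (c′≢c (treeVec-tree c′ l′ c l (trans (≡.sym (edgeVec-pair same (treeEdge c l))) at-c)))
    nonTree-coordinate : ∀ k → edgeVec a b (nonTree k) ≡ false
    nonTree-coordinate k = trans (edgeVec-pair same (nonTree k)) (treeVec-nonTree c′ l′ k)
  ... | inj₂ (k₀ , eq) = begin
    edgeVec a b (treeEdge c l) xor ∑[ k < r ] (crosses c k ∧ edgeVec a b (nonTree k))
      ≡⟨ cong₂ _xor_ (trans (edgeVec-pair same (treeEdge c l)) (nonTreeVec-tree k₀ c l)) cut-sum ⟩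
    crosses c k₀                        ≡⟨ below-pair c same ⟨
    below c a xor below c b             ∎
    where
    same : SamePair a b (lo (nonTree k₀)) (hi (nonTree k₀))
    same = subst (λ z → SamePair a b (lo z) (hi z)) (≡.sym eq) (mkEdge-pair a b ab)
    only-k₀ : ∀ k → k ≢ k₀ → edgeVec a b (nonTree k) ≡ false
    only-k₀ k k≢k₀ with edgeVec a b (nonTree k) in at-k
    ... | false = refl
    ... | true  = ⊥-elim (k≢k₀ (≡.sym (nonTreeVec-nonTree k₀ k (trans (≡.sym (edgeVec-pair same (nonTree k))) at-k))))
    cut-sum : ∑[ k < r ] (crosses c k ∧ edgeVec a b (nonTree k)) ≡ crosses c k₀
    cut-sum = begin
      ∑[ k < r ] (crosses c k ∧ edgeVec a b (nonTree k))
        ≡⟨ sum-single _ k₀ (λ k k≢k₀ → trans (cong (crosses c k ∧_) (only-k₀ k k≢k₀)) (∧-zeroʳ _)) ⟩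
      crosses c k₀ ∧ edgeVec a b (nonTree k₀)
        ≡⟨ cong (crosses c k₀ ∧_) (trans (edgeVec-pair same (nonTree k₀)) (edgeVec-self (nonTree k₀))) ⟩
      crosses c k₀ ∧ true                 ≡⟨ ∧-identityʳ _ ⟩
      crosses c k₀                        ∎

  -- every closed walk satisfies the cut equations: summing the balance of
  -- its steps, the right-hand sides telescope to 0
  cycle-cut : ∀ C → CutEquations (cycleVec C)
  cycle-cut C c l = xor≡false⇒≡ _ _ (begin
    cycleVec C (treeEdge c l) xor ∑[ k < r ] (crosses c k ∧ cycleVec C (nonTree k))
      ≡⟨ cong (cycleVec C (treeEdge c l) xor_) regroup ⟩
    ∑[ t < suc K ] edgeVec (at t) (at (next t)) (treeEdge c l) xor ∑[ t < suc K ] cut t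
      ≡⟨ ∑-distrib-+ (λ t → edgeVec (at t) (at (next t)) (treeEdge c l)) cut ⟨
    ∑[ t < suc K ] (edgeVec (at t) (at (next t)) (treeEdge c l) xor cut t)
      ≡⟨ sum-cong-≗ (λ t → step-balance c l (at t) (at (next t)) (adjacent t)) ⟩
    ∑[ t < suc K ] (below c (at t) xor below c (at (next t)))
      ≡⟨ telescope (λ t → below c (at t)) ⟩
    false                                                    ∎)
    where
    open CyclicWalk C renaming (k to K)
    cut : Fin (suc K) → Bool
    cut t = ∑[ k < r ] (crosses c k ∧ edgeVec (at t) (at (next t)) (nonTree k))
    regroup : ∑[ k < r ] (crosses c k ∧ cycleVec C (nonTree k)) ≡ ∑[ t < suc K ] cut t
    regroup = begin
      ∑[ k < r ] (crosses c k ∧ cycleVec C (nonTree k))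
        ≡⟨ sum-cong-≗ (λ k → *-distribˡ-sum (crosses c k) (λ t → edgeVec (at t) (at (next t)) (nonTree k))) ⟩
      ∑[ k < r ] ∑[ t < suc K ] (crosses c k ∧ edgeVec (at t) (at (next t)) (nonTree k))
        ≡⟨ ∑-comm (λ k t → crosses c k ∧ edgeVec (at t) (at (next t)) (nonTree k)) ⟩
      ∑[ t < suc K ] cut t ∎

  cut-ext : ∀ {v w : EVec G} → (∀ e → v e ≡ w e) → CutEquations w → CutEquations v
  cut-ext v≗w cw c l = trans (v≗w (treeEdge c l)) (trans (cw c l) (sum-cong-≗ λ k → cong (crosses c _ ∧_) (≡.sym (v≗w (nonTree k)))))

  cut-zero : CutEquations (λ _ → false)
  cut-zero c l = ≡.sym (sum-zero _ λ k → ∧-zeroʳ (crosses c k))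

  cut-xor : ∀ (v w : EVec G) → CutEquations v → CutEquations w → CutEquations (λ e → v e xor w e)
  cut-xor v w cv cw c l = begin
    v (treeEdge c l) xor w (treeEdge c l)    ≡⟨ cong₂ _xor_ (cv c l) (cw c l) ⟩
    ∑[ k < r ] (crosses c k ∧ v (nonTree k)) xor ∑[ k < r ] (crosses c k ∧ w (nonTree k))
      ≡⟨ ∑-distrib-+ (λ k → crosses c k ∧ v (nonTree k)) (λ k → crosses c k ∧ w (nonTree k)) ⟨
    ∑[ k < r ] ((crosses c k ∧ v (nonTree k)) xor (crosses c k ∧ w (nonTree k)))
      ≡⟨ sum-cong-≗ (λ k → ∧-distribˡ-xor (crosses c k) (v (nonTree k)) (w (nonTree k))) ⟨
    ∑[ k < r ] (crosses c k ∧ (v (nonTree k) xor w (nonTree k))) ∎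

  cut-scale : ∀ a {v : EVec G} → CutEquations v → CutEquations (λ e → a ∧ v e)
  cut-scale true  cv = cv
  cut-scale false _  = cut-zero

  cut-lincomb : ∀ {d} (c : Fin d → Bool) (b : Fin d → EVec G) → (∀ i → CutEquations (b i)) → CutEquations (lincomb G c b)
  cut-lincomb {zero}  c b cb = cut-zero
  cut-lincomb {suc d} c b cb = cut-xor (λ e → c zero ∧ b zero e) (lincomb G (λ i → c (suc i)) (λ i → b (suc i)))
    (cut-scale (c zero) {b zero} (cb zero)) (cut-lincomb (λ i → c (suc i)) (λ i → b (suc i)) (λ i → cb (suc i)))

  holeSpace-cut : ∀ {v} → InHoleSpace G v → CutEquations v
  holeSpace-cut (L , v≡) = cut-ext v≡ (holes L)
    where
    holes : ∀ L → CutEquations (λ e → foldr _xor_ false (map (λ C → χ C e) L))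
    holes []      = cut-zero
    holes (C ∷ L) = cut-xor (χ C) (λ e → foldr _xor_ false (map (λ C → χ C e) L))
                            (cut-ext (χ≡cycleVec C) (cycle-cut (holeWalk C))) (holes L)

-- The fundamental cycle of the non-tree edge {a, b} is
-- a – b, then up the tree from b to the root, then down from the root to a.
-- It lies in 𝓗(G) by HoleSpan, and among the non-tree edges it uses only
-- {a, b}; the cut equations then force any v ∈ 𝓗(G) to equal the
-- combination of fundamental cycles with coefficients v(nonTree k).
module FundamentalCycles {n : ℕ} (G : Graph (suc n)) (connected : Connected G) (triangle-free : TriangleFree G) where

  open import Data.Bool using (Bool; true; false; _∧_; _xor_)
  open import Data.Bool.Properties using (xor-identityʳ; xor-same; ∧-zeroʳ; ∧-identityʳ)
  open import Data.Nat.Properties using (_<?_; m≤m+n; ≤-pred; ≰⇒>)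
  open import Data.Fin using (Fin)
  open import Data.List using (List; []; _∷_; _++_; [_])
  open import Data.List.Relation.Unary.All using (All; []; _∷_)
  import Data.List.Relation.Unary.All.Properties as All
  open import Data.Product using (Σ; _×_; _,_; proj₁; proj₂)
  open import Data.Sum using (inj₁; inj₂)
  open import Data.Empty using (⊥-elim)
  open import Relation.Nullary using (yes; no)
  open import Relation.Binary.PropositionalEquality using (_≡_; _≢_; refl; cong; subst; trans)
  import Relation.Binary.PropositionalEquality as ≡
  open ≡.≡-Reasoning
  open F₂
  open EdgeSpace G
  open HoleSpan G connected triangle-free public
  open CutEquations G connected using (root-of; CutEquations; holeSpace-cut; cut-lincomb; cycle-cut; cut-ext; cut-xor)

  data Walk : V → V → Set where
    []  : ∀ {x} → Walk x x
    _∷_ : ∀ {x y z} → adj G x y ≡ true → Walk y z → Walk x z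

  _++ʷ_ : ∀ {x y z} → Walk x y → Walk y z → Walk x z
  []       ++ʷ w₂ = w₂
  (a ∷ w₁) ++ʷ w₂ = a ∷ (w₁ ++ʷ w₂)

  reverse : ∀ {x y} → Walk x y → Walk y x
  reverse []                 = []
  reverse (_∷_ {x} {y} a w) = reverse w ++ʷ (trans (Graph.sym G y x) a ∷ [])

  vertices : ∀ {x y} → Walk x y → List V
  vertices []                = []
  vertices (_∷_ {x} _ w) = x ∷ vertices w

  walkSteps : ∀ {x y} → Walk x y → List (V × V)
  walkSteps []                  = []
  walkSteps (_∷_ {x} {y} _ w) = (x , y) ∷ walkSteps w

  walkSteps-++ : ∀ {x y z} (w₁ : Walk x y) (w₂ : Walk y z) → walkSteps (w₁ ++ʷ w₂) ≡ walkSteps w₁ ++ walkSteps w₂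
  walkSteps-++ []                   w₂ = refl
  walkSteps-++ (_∷_ {x} {y} _ w₁) w₂ = cong ((x , y) ∷_) (walkSteps-++ w₁ w₂)

  closedSteps-walk : ∀ {x} (w : Walk x x) → closedSteps (vertices w) ≡ walkSteps w
  closedSteps-walk []        = refl
  closedSteps-walk w@(_ ∷ _) = path w
    where
    path : ∀ {x z} (w : Walk x z) → steps (vertices w ++ [ z ]) ≡ walkSteps w
    path []                   = refl
    path (_∷_ {x} {y} _ [])   = refl
    path (_∷_ {x} {y} _ (a ∷ w)) = cong ((x , y) ∷_) (path (a ∷ w))

  walkSteps-adjacent : ∀ {x y} (w : Walk x y) → AllAdjacent (walkSteps w)
  walkSteps-adjacent []      = []
  walkSteps-adjacent (a ∷ w) = a ∷ walkSteps-adjacent w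

  TreeStep : V × V → Set
  TreeStep (a , b) = IsTreePair a b

  reverse-tree : ∀ {x y} (w : Walk x y) → All TreeStep (walkSteps w) → All TreeStep (walkSteps (reverse w))
  reverse-tree []                  _                    = []
  reverse-tree (_∷_ {x} {y} a w) ((c , l , same) ∷ ts)
    rewrite walkSteps-++ (reverse w) (trans (Graph.sym G y x) a ∷ []) =
      All.++⁺ (reverse-tree w ts) ((c , l , pair-trans pair-swap same) ∷ [])

  treePath-nonTree : ∀ ps → All TreeStep ps → ∀ k → pathVec ps (nonTree k) ≡ false
  treePath-nonTree []             []                   k = refl
  treePath-nonTree ((a , b) ∷ ps) ((c , l , same) ∷ ts) k rewrite treePath-nonTree ps ts k =
    trans (xor-identityʳ _) (trans (edgeVec-pair same (nonTree k)) (treeVec-nonTree c l k))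

  TreePathToRoot : V → Set
  TreePathToRoot v = Σ (Walk v ρ) λ w → All TreeStep (walkSteps w)

  up : ∀ f v → n ≤ f + idx v → TreePathToRoot v
  up zero    v enough = subst TreePathToRoot (≡.sym (root-of v enough)) ([] , [])
  up (suc f) v enough with idx v <? n
  ... | no  v≮n = subst TreePathToRoot (≡.sym (root-of v (≤-pred (≰⇒> v≮n)))) ([] , [])
  ... | yes v<n with up f (parent-of v) (fuel-parent f v v<n enough)
  ...   | w , ts = proj₂ (parent-of-ok v v<n) ∷ w , (v , v<n , inj₁ (refl , refl)) ∷ ts

  toRoot : ∀ v → TreePathToRoot v
  toRoot v = up n v (m≤m+n n (idx v))

  returnPath : ∀ k → Walk (hi (nonTree k)) (lo (nonTree k))
  returnPath k = proj₁ (toRoot (hi (nonTree k))) ++ʷ reverse (proj₁ (toRoot (lo (nonTree k))))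

  fundamentalWalk : ∀ k → Walk (lo (nonTree k)) (lo (nonTree k))
  fundamentalWalk k = proj₂ (proj₂ (nonTree k)) ∷ returnPath k

  fundamental : Fin r → EVec G
  fundamental k = pathVec (walkSteps (fundamentalWalk k))

  fundamental-closed : ∀ k → IsClosedWalk (vertices (fundamentalWalk k))
  fundamental-closed k = subst AllAdjacent (≡.sym (closedSteps-walk (fundamentalWalk k))) (walkSteps-adjacent (fundamentalWalk k))

  fundamental≗ : ∀ k e → fundamental k e ≡ pathVec (closedSteps (vertices (fundamentalWalk k))) e
  fundamental≗ k e = cong (λ ps → pathVec ps e) (≡.sym (closedSteps-walk (fundamentalWalk k)))

  fundamental∈H : ∀ k → InH (fundamental k)
  fundamental∈H k = InH-ext (fundamental≗ k) (closedWalk∈H (lo (nonTree k)) (vertices (returnPath k)) (fundamental-closed k))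

  fundamental-cut : ∀ k → CutEquations (fundamental k)
  fundamental-cut k = cut-ext (λ e → trans (fundamental≗ k e) (≡.sym (listWalk-vec _ _ (fundamental-closed k) e)))
                              (cycle-cut (listWalk _ _ (fundamental-closed k)))

  fundamental-at-nonTree : ∀ k k′ → fundamental k (nonTree k′) ≡ edgeVec (lo (nonTree k)) (hi (nonTree k)) (nonTree k′)
  fundamental-at-nonTree k k′ = begin
    edgeVec (lo (nonTree k)) (hi (nonTree k)) (nonTree k′) xor pathVec (walkSteps (returnPath k)) (nonTree k′)
      ≡⟨ cong (edgeVec (lo (nonTree k)) (hi (nonTree k)) (nonTree k′) xor_) return-free ⟩
    edgeVec (lo (nonTree k)) (hi (nonTree k)) (nonTree k′) xor false
      ≡⟨ xor-identityʳ _ ⟩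
    edgeVec (lo (nonTree k)) (hi (nonTree k)) (nonTree k′) ∎
    where
    up-b : TreePathToRoot (hi (nonTree k))
    up-b = toRoot (hi (nonTree k))
    up-a : TreePathToRoot (lo (nonTree k))
    up-a = toRoot (lo (nonTree k))
    return-free : pathVec (walkSteps (returnPath k)) (nonTree k′) ≡ false
    return-free rewrite walkSteps-++ (proj₁ up-b) (reverse (proj₁ up-a))
                      | pathVec-++ (walkSteps (proj₁ up-b)) (walkSteps (reverse (proj₁ up-a))) (nonTree k′)
                      | treePath-nonTree _ (proj₂ up-b) k′
                      | treePath-nonTree _ (reverse-tree (proj₁ up-a) (proj₂ up-a)) k′ = refl

  fundamental-self : ∀ k → fundamental k (nonTree k) ≡ true
  fundamental-self k = trans (fundamental-at-nonTree k k) (edgeVec-self (nonTree k))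

  fundamental-other : ∀ k k′ → k ≢ k′ → fundamental k (nonTree k′) ≡ false
  fundamental-other k k′ k≢k′ with fundamental k (nonTree k′) in at-k′
  ... | false = refl
  ... | true  = ⊥-elim (k≢k′ (nonTreeVec-nonTree k k′ (trans (≡.sym (fundamental-at-nonTree k k′)) at-k′)))

  lincomb-at-nonTree : ∀ (c : Fin r → Bool) k → lincomb G c fundamental (nonTree k) ≡ c k
  lincomb-at-nonTree c k = begin
    lincomb G c fundamental (nonTree k)               ≡⟨ lincomb≡sum c fundamental (nonTree k) ⟩
    ∑[ i < r ] (c i ∧ fundamental i (nonTree k))
      ≡⟨ sum-single _ k (λ i i≢k → trans (cong (c i ∧_) (fundamental-other i k i≢k)) (∧-zeroʳ (c i))) ⟩
    c k ∧ fundamental k (nonTree k)                   ≡⟨ cong (c k ∧_) (fundamental-self k) ⟩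
    c k ∧ true                                        ≡⟨ ∧-identityʳ (c k) ⟩
    c k                                               ∎

  fundamental-independent : LinIndep G fundamental
  fundamental-independent c vanishes k = trans (≡.sym (lincomb-at-nonTree c k)) (vanishes (nonTree k))

  -- v ∈ 𝓗(G) equals Σ_k v(nonTree k) · fundamental k: their difference is zero
  -- on the non-tree edges and satisfies the cut equations, hence is zero
  fundamental-spans : ∀ v → InHoleSpace G v → InSpan G fundamental v
  fundamental-spans v v∈H = c , λ e → xor≡false⇒≡ (v e) (lincomb G c fundamental e) (difference-zero e)
    where
    c : Fin r → Bool
    c k = v (nonTree k)
    difference : EVec G
    difference e = v e xor lincomb G c fundamental e
    difference-cut : CutEquations difference
    difference-cut = cut-xor v (lincomb G c fundamental) (holeSpace-cut v∈H) (cut-lincomb c fundamental fundamental-cut)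
    difference-nonTree : ∀ k → difference (nonTree k) ≡ false
    difference-nonTree k = trans (cong (v (nonTree k) xor_) (lincomb-at-nonTree c k)) (xor-same (v (nonTree k)))
    difference-zero : ∀ e → difference e ≡ false
    difference-zero e with classify e
    ... | inj₂ (k , refl)      = difference-nonTree k
    ... | inj₁ (c′ , l , refl) = trans (difference-cut c′ l)
            (sum-zero _ λ k → trans (cong (_ ∧_) (difference-nonTree k)) (∧-zeroʳ _))

  holeSpaceDim : HoleSpaceDim G r
  holeSpaceDim = fundamental , fundamental∈H , fundamental-independent , fundamental-spans

module WithIsolated {m : ℕ} (G : Graph m) (k : ℕ) where

  open import Data.Bool using (false)
  open import Data.Fin using (Fin; _↑ˡ_; _↑ʳ_; splitAt)
  open import Data.Fin.Properties using (splitAt-↑ˡ; splitAt-↑ʳ; splitAt⁻¹-↑ˡ; splitAt⁻¹-↑ʳ)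
  open import Data.Sum using (inj₁; inj₂)
  open import Relation.Binary.PropositionalEquality using (_≡_; refl; subst)

  data View : Fin (m + k) → Set where
    old : (u : Fin m) → View (u ↑ˡ k)
    new : (j : Fin k) → View (m ↑ʳ j)

  view : ∀ x → View x
  view x with splitAt m x in eq
  ... | inj₁ u = subst View (splitAt⁻¹-↑ˡ eq) (old u)
  ... | inj₂ j = subst View (splitAt⁻¹-↑ʳ eq) (new j)

  addIsolated-old : ∀ u u′ → addIsolated G k (u ↑ˡ k) (u′ ↑ˡ k) ≡ adj G u u′
  addIsolated-old u u′ rewrite splitAt-↑ˡ m u k | splitAt-↑ˡ m u′ k = refl

  addIsolated-newˡ : ∀ j y → addIsolated G k (m ↑ʳ j) y ≡ false
  addIsolated-newˡ j y rewrite splitAt-↑ʳ m k j = refl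

  addIsolated-newʳ : ∀ x j → addIsolated G k x (m ↑ʳ j) ≡ false
  addIsolated-newʳ x j rewrite splitAt-↑ʳ m k j with splitAt m x
  ... | inj₁ _ = refl
  ... | inj₂ _ = refl

-- k(G) ≤ r + 1.  Let the vertices be ord 0, …, ord n (n = n′ + 1, ρ = ord n)
-- and add r + 1 new vertices.  Every edge gets its own "sink": the tree edge
-- of ord (q + 1) gets the old vertex ord q (q < n′), the tree edge of ord 0
-- gets the first new vertex, and the non-tree edges get the other new ones.
-- The arcs go from the two endpoints of each edge to its sink; they lower
-- the position in the order, so the digraph is acyclic, and two old vertices
-- share an out-neighbour exactly when they form an edge.
module UpperBound {n′ : ℕ} (G : Graph (suc (suc n′))) (connected : Connected G) where

  open import Data.Bool using (Bool; true; false; _∨_)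
  open import Data.Bool.Properties using (∨-zeroʳ)
  open import Data.Nat using (_<_; z≤n)
  open import Data.Nat.Properties using (<-irrefl; <-trans; _<?_; ≤-refl; n<1+n; m≤n⇒m≤1+n; ≤-pred; <-irrelevant)
  open import Data.Fin using (Fin; zero; suc; _≟_; _↑ˡ_; _↑ʳ_; splitAt; fromℕ<)
  open import Data.Fin.Properties using (splitAt-↑ˡ; splitAt-↑ʳ; toℕ-fromℕ<)
  open import Data.Maybe using (Maybe; just; nothing)
  open import Data.Product using (Σ; ∃; _×_; _,_; proj₁; proj₂)
  open import Data.Sum using (_⊎_; inj₁; inj₂)
  open import Data.Empty using (⊥-elim)
  open import Relation.Nullary using (yes; no)
  open import Relation.Nullary.Decidable using (⌊_⌋)
  open import Relation.Binary.PropositionalEquality using (_≡_; _≢_; refl; cong; subst; trans)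
  import Relation.Binary.PropositionalEquality as ≡
  open Basics
  open Edges G connected

  n : ℕ
  n = suc n′

  K : ℕ
  K = suc r

  open WithIsolated G K

  treeEdge-cong : ∀ {c c′} (l : idx c < n) (l′ : idx c′ < n) → c ≡ c′ → treeEdge c l ≡ treeEdge c′ l′
  treeEdge-cong {c} l l′ refl = cong (treeEdge c) (<-irrelevant l l′)

  successor : ∀ u → idx u < n′ → V
  successor u lt = ord (fromℕ< (s≤s (m≤n⇒m≤1+n lt)))

  idx-successor : ∀ u lt → idx (successor u lt) ≡ suc (idx u)
  idx-successor u lt = trans (idx-ord _) (toℕ-fromℕ< (s≤s (m≤n⇒m≤1+n lt)))

  successor-nonroot : ∀ u lt → idx (successor u lt) < n
  successor-nonroot u lt = subst (_< n) (≡.sym (idx-successor u lt)) (s≤s lt)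

  first-nonroot : idx (ord zero) < n
  first-nonroot = subst (_< n) (≡.sym (idx-ord zero)) (s≤s z≤n)

  assignedOld : V → Maybe (Edge G)
  assignedOld u with idx u <? n′
  ... | yes lt = just (treeEdge (successor u lt) (successor-nonroot u lt))
  ... | no  _  = nothing

  assignedNew : Fin K → Maybe (Edge G)
  assignedNew zero    = just (treeEdge (ord zero) first-nonroot)
  assignedNew (suc k) = just (nonTree k)

  assigned : Fin (suc n + K) → Maybe (Edge G)
  assigned x with splitAt (suc n) x
  ... | inj₁ u = assignedOld u
  ... | inj₂ j = assignedNew j

  assigned-old : ∀ u → assigned (u ↑ˡ K) ≡ assignedOld u
  assigned-old u rewrite splitAt-↑ˡ (suc n) u K = refl

  assigned-new : ∀ j → assigned (suc n ↑ʳ j) ≡ assignedNew j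
  assigned-new j rewrite splitAt-↑ʳ (suc n) K j = refl

  endpoint : V → Maybe (Edge G) → Bool
  endpoint u nothing  = false
  endpoint u (just e) = ⌊ u ≟ lo e ⌋ ∨ ⌊ u ≟ hi e ⌋

  endpoint-sound : ∀ u e → endpoint u (just e) ≡ true → u ≡ lo e ⊎ u ≡ hi e
  endpoint-sound u e t with u ≟ lo e | u ≟ hi e
  ... | yes u≡lo | _        = inj₁ u≡lo
  ... | no  _    | yes u≡hi = inj₂ u≡hi

  endpoint-lo : ∀ e → endpoint (lo e) (just e) ≡ true
  endpoint-lo e rewrite isYes-complete (lo e ≟ lo e) refl = refl

  endpoint-hi : ∀ e → endpoint (hi e) (just e) ≡ true
  endpoint-hi e rewrite isYes-complete (hi e ≟ hi e) refl = ∨-zeroʳ _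

  Arc : Digraph (suc n + K)
  Arc x y with splitAt (suc n) x
  ... | inj₁ u = endpoint u (assigned y)
  ... | inj₂ _ = false

  Arc-old : ∀ u y → Arc (u ↑ˡ K) y ≡ endpoint u (assigned y)
  Arc-old u y rewrite splitAt-↑ˡ (suc n) u K = refl

  Arc-new : ∀ j y → Arc (suc n ↑ʳ j) y ≡ false
  Arc-new j y rewrite splitAt-↑ʳ (suc n) K j = refl

  rank : Fin (suc n + K) → ℕ
  rank x with splitAt (suc n) x
  ... | inj₁ u = suc (idx u)
  ... | inj₂ _ = 0

  rank-old : ∀ u → rank (u ↑ˡ K) ≡ suc (idx u)
  rank-old u rewrite splitAt-↑ˡ (suc n) u K = refl

  rank-new : ∀ j → rank (suc n ↑ʳ j) ≡ 0
  rank-new j rewrite splitAt-↑ʳ (suc n) K j = refl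

  endpoint-pair : ∀ {a b u} e → SamePair a b (lo e) (hi e) → u ≡ lo e ⊎ u ≡ hi e → u ≡ a ⊎ u ≡ b
  endpoint-pair e (inj₁ (a≡lo , b≡hi)) (inj₁ u≡lo) = inj₁ (trans u≡lo (≡.sym a≡lo))
  endpoint-pair e (inj₁ (a≡lo , b≡hi)) (inj₂ u≡hi) = inj₂ (trans u≡hi (≡.sym b≡hi))
  endpoint-pair e (inj₂ (a≡hi , b≡lo)) (inj₁ u≡lo) = inj₂ (trans u≡lo (≡.sym b≡lo))
  endpoint-pair e (inj₂ (a≡hi , b≡lo)) (inj₂ u≡hi) = inj₁ (trans u≡hi (≡.sym a≡hi))

  assignedOld-below : ∀ u′ u → endpoint u (assignedOld u′) ≡ true → idx u′ < idx u
  assignedOld-below u′ u t with idx u′ <? n′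
  ... | no  _  = ⊥-elim (true≢false (≡.sym t))
  ... | yes lt with endpoint-pair (treeEdge (successor u′ lt) (successor-nonroot u′ lt))
                      (treeEdge-pair (successor u′ lt) (successor-nonroot u′ lt))
                      (endpoint-sound u (treeEdge (successor u′ lt) (successor-nonroot u′ lt)) t)
  ...   | inj₁ refl = subst (idx u′ <_) (≡.sym (idx-successor u′ lt)) ≤-refl
  ...   | inj₂ refl = <-trans (subst (idx u′ <_) (≡.sym (idx-successor u′ lt)) ≤-refl)
                                (proj₁ (parent-of-ok (successor u′ lt) (successor-nonroot u′ lt)))

  arc-rank : ∀ x y → Arc x y ≡ true → rank y < rank x
  arc-rank x y t with view x
  ... | new j = ⊥-elim (true≢false (trans (≡.sym t) (Arc-new j y)))
  ... | old u with view y
  ...   | new j  rewrite rank-old u | rank-new j = s≤s z≤n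
  ...   | old u′ rewrite rank-old u | rank-old u′ =
    s≤s (assignedOld-below u′ u (trans (cong (endpoint u) (≡.sym (assigned-old u′))) (trans (≡.sym (Arc-old u (u′ ↑ˡ K))) t)))

  path-rank : ∀ {x y} → DPath Arc x y → rank y < rank x
  path-rank (arc {x} {y} a)     = arc-rank x y a
  path-rank (_∷ᵈ_ {x} {y} a p) = <-trans (path-rank p) (arc-rank x y a)

  acyclic : Acyclic Arc
  acyclic x cycle = <-irrefl refl (path-rank cycle)

  assignedOld-yes : ∀ u (lt : idx u < n′) → assignedOld u ≡ just (treeEdge (successor u lt) (successor-nonroot u lt))
  assignedOld-yes u lt with idx u <? n′
  ... | yes lt′ rewrite <-irrelevant lt lt′ = refl
  ... | no  ¬lt = ⊥-elim (¬lt lt)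

  treeSink : ∀ c (l : idx c < n) → Σ (Fin (suc n + K)) λ v → assigned v ≡ just (treeEdge c l)
  treeSink c l = at-position (idx c) refl
    where
    at-position : ∀ q → idx c ≡ q → Σ (Fin (suc n + K)) λ v → assigned v ≡ just (treeEdge c l)
    at-position zero idx≡0 = suc n ↑ʳ zero ,
      trans (assigned-new zero) (cong just (treeEdge-cong first-nonroot l (idx-inj _ _ (trans (idx-ord zero) (≡.sym idx≡0)))))
    at-position (suc q) idx≡ = u ↑ˡ K ,
      trans (assigned-old u) (trans (assignedOld-yes u u<n′) (cong just (treeEdge-cong (successor-nonroot u u<n′) l successor≡c)))
      where
      q<n′ : q < n′
      q<n′ = ≤-pred (subst (_< n) idx≡ l)
      u : V
      u = ord (fromℕ< (<-trans q<n′ (<-trans (n<1+n n′) (n<1+n n))))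
      idx-u : idx u ≡ q
      idx-u = trans (idx-ord _) (toℕ-fromℕ< _)
      u<n′ : idx u < n′
      u<n′ = subst (_< n′) (≡.sym idx-u) q<n′
      successor≡c : successor u u<n′ ≡ c
      successor≡c = idx-inj _ _ (trans (idx-successor u u<n′) (trans (cong suc idx-u) (≡.sym idx≡)))

  arcs-to-sink : ∀ u u′ e v → assigned v ≡ just e → SamePair u u′ (lo e) (hi e) →
    Arc (u ↑ˡ K) v ≡ true × Arc (u′ ↑ˡ K) v ≡ true
  arcs-to-sink u u′ e v sink (inj₁ (refl , refl)) rewrite Arc-old u v | Arc-old u′ v | sink = endpoint-lo e , endpoint-hi e
  arcs-to-sink u u′ e v sink (inj₂ (refl , refl)) rewrite Arc-old u v | Arc-old u′ v | sink = endpoint-hi e , endpoint-lo e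

  shared-sink : ∀ u u′ s → u ≢ u′ → endpoint u s ≡ true → endpoint u′ s ≡ true → adj G u u′ ≡ true
  shared-sink u u′ (just e) u≢u′ tu tu′ with endpoint-sound u e tu | endpoint-sound u′ e tu′
  ... | inj₁ refl | inj₁ refl = ⊥-elim (u≢u′ refl)
  ... | inj₁ refl | inj₂ refl = proj₂ (proj₂ e)
  ... | inj₂ refl | inj₁ refl = trans (Graph.sym G (hi e) (lo e)) (proj₂ (proj₂ e))
  ... | inj₂ refl | inj₂ refl = ⊥-elim (u≢u′ refl)

  competition : IsCompetitionGraphOf G K Arc
  competition x y x≢y = common-sink⇒edge x y x≢y , edge⇒common-sink x y
    where
    common-sink⇒edge : ∀ x y → x ≢ y → (∃ λ v → Arc x v ≡ true × Arc y v ≡ true) → addIsolated G K x y ≡ true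
    common-sink⇒edge x y x≢y (v , xv , yv) with view x | view y
    ... | new j | _     = ⊥-elim (true≢false (trans (≡.sym xv) (Arc-new j v)))
    ... | old u | new j = ⊥-elim (true≢false (trans (≡.sym yv) (Arc-new j v)))
    ... | old u | old u′ = trans (addIsolated-old u u′)
      (shared-sink u u′ (assigned v) (λ u≡u′ → x≢y (cong (_↑ˡ K) u≡u′))
        (trans (≡.sym (Arc-old u v)) xv) (trans (≡.sym (Arc-old u′ v)) yv))
    edge⇒common-sink : ∀ x y → addIsolated G K x y ≡ true → ∃ λ v → Arc x v ≡ true × Arc y v ≡ true
    edge⇒common-sink x y t with view x | view y
    ... | new j | _     = ⊥-elim (true≢false (trans (≡.sym t) (addIsolated-newˡ j y)))
    ... | old u | new j = ⊥-elim (true≢false (trans (≡.sym t) (addIsolated-newʳ (u ↑ˡ K) j)))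
    ... | old u | old u′ with classify (mkEdge u u′ uu′)
      where
      uu′ : adj G u u′ ≡ true
      uu′ = trans (≡.sym (addIsolated-old u u′)) t
    ...   | inj₁ (c , l , eq) with treeSink c l
    ...     | v , sink = v , arcs-to-sink u u′ (treeEdge c l) v sink
                               (subst (λ e → SamePair u u′ (lo e) (hi e)) (≡.sym eq) (mkEdge-pair u u′ _))
    edge⇒common-sink x y t | old u | old u′ | inj₂ (k , eq) =
      suc n ↑ʳ suc k , arcs-to-sink u u′ (nonTree k) (suc n ↑ʳ suc k) (assigned-new (suc k))
                         (subst (λ e → SamePair u u′ (lo e) (hi e)) (≡.sym eq) (mkEdge-pair u u′ _))

  upperBound : CompRep G K
  upperBound = Arc , acyclic , competition

-- Walk backwards
-- along arcs inside the set; the walk cannot revisit a vertex (that would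
-- close a directed cycle), so it stops within M steps.
module MinimalElement {M : ℕ} (A : Digraph M) (acyclic : Acyclic A) where

  open import Data.Bool using (true; false)
  import Data.Bool.Properties as Boolₚ
  open import Data.Nat.Properties using (+-suc; +-identityʳ; <-irrefl)
  open import Data.Fin using (Fin; zero; suc; _≟_)
  open import Data.Fin.Properties using (any?; injective⇒≤)
  open import Data.Product using (Σ; _×_; _,_)
  open import Data.Empty using (⊥-elim)
  open import Relation.Nullary using (yes; no)
  open import Relation.Nullary.Decidable using (_×-dec_)
  open import Level using (0ℓ)
  open import Relation.Unary using (Pred; Decidable)
  open import Relation.Binary.PropositionalEquality using (_≡_; _≢_; refl; cong; trans)
  import Relation.Binary.PropositionalEquality as ≡

  Minimal : Pred (Fin M) 0ℓ → Set
  Minimal P = Σ (Fin M) λ v → P v × (∀ z → P z → A z v ≡ false)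

  _◃_ : ∀ {m} → Fin M → (Fin m → Fin M) → Fin (suc m) → Fin M
  (c ◃ visited) zero    = c
  (c ◃ visited) (suc i) = visited i

  ◃-injective : ∀ {m} c (visited : Fin m → Fin M) → (∀ i i′ → visited i ≡ visited i′ → i ≡ i′) →
    (∀ i → visited i ≢ c) → ∀ i i′ → (c ◃ visited) i ≡ (c ◃ visited) i′ → i ≡ i′
  ◃-injective c visited inj fresh zero    zero     _  = refl
  ◃-injective c visited inj fresh zero    (suc i′) eq = ⊥-elim (fresh i′ (≡.sym eq))
  ◃-injective c visited inj fresh (suc i) zero     eq = ⊥-elim (fresh i eq)
  ◃-injective c visited inj fresh (suc i) (suc i′) eq = cong suc (inj i i′ eq)

  module _ (P : Pred (Fin M) 0ℓ) (P? : Decidable P) where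

    -- state: the current vertex cur ∈ P and m distinct earlier vertices,
    -- each reachable from cur by a directed path
    search : ∀ fuel m → m + fuel ≡ M → (cur : Fin M) → P cur →
      (visited : Fin m → Fin M) → (∀ i i′ → visited i ≡ visited i′ → i ≡ i′) →
      (∀ i → visited i ≢ cur) → (∀ i → DPath A cur (visited i)) → Minimal P
    search zero m m≡M cur _ visited inj fresh _ =
      ⊥-elim (<-irrefl (trans (≡.sym (+-identityʳ m)) m≡M) (injective⇒≤ {f = cur ◃ visited} (◃-injective cur visited inj fresh _ _)))
    search (suc fuel) m m+fuel≡M cur P-cur visited inj fresh paths
      with any? (λ z → P? z ×-dec (A z cur Boolₚ.≟ true))
    ... | no none = cur , P-cur , λ z P-z → Boolₚ.¬-not (λ zc → none (z , P-z , zc))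
    ... | yes (z , P-z , zc) with z ≟ cur
    ...   | yes refl = ⊥-elim (acyclic cur (arc zc))
    ...   | no  z≢cur with any? (λ i → visited i ≟ z)
    ...     | yes (i , refl) = ⊥-elim (acyclic z (zc ∷ᵈ paths i))
    ...     | no  z-new      = search fuel (suc m) (trans (≡.sym (+-suc m fuel)) m+fuel≡M) z P-z
                                 (cur ◃ visited) (◃-injective cur visited inj fresh) fresh′ paths′
      where
      fresh′ : ∀ i → (cur ◃ visited) i ≢ z
      fresh′ zero    eq = z≢cur (≡.sym eq)
      fresh′ (suc i) eq = z-new (i , eq)
      paths′ : ∀ i → DPath A z ((cur ◃ visited) i)
      paths′ zero    = arc zc
      paths′ (suc i) = zc ∷ᵈ paths i

    minimal : ∀ v₀ → P v₀ → Minimal P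
    minimal v₀ P-v₀ = search M 0 refl v₀ P-v₀ (λ ()) (λ ()) (λ ()) (λ ())

-- k(G) ≥ r + 1.  Let D be acyclic with C(D) = G ∪ I_j, on M = n + 1 + j
-- vertices.  Each of the n + r edges e of G has a common out-neighbour
-- sink e of its endpoints; since G is triangle-free, the old in-neighbours
-- of sink e are exactly the endpoints of e, so distinct edges have distinct
-- sinks.  No sink is a source s of D, nor a minimal vertex b of D − s
-- (whose only possible in-neighbour is s).  Hence n + r ≤ M − 2.
module LowerBound {n′ : ℕ} (G : Graph (suc (suc n′))) (connected : Connected G) (triangle-free : TriangleFree G) where

  open import Data.Bool using (true; false)
  open import Data.Unit using (⊤; tt)
  open import Data.Nat using (_<_)
  open import Data.Nat.Properties using (+-suc; +-cancelˡ-≤)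
  open import Data.Fin using (Fin; zero; suc; _≟_; _↑ˡ_; splitAt; join; inject₁)
  open import Data.Fin.Properties using (↑ˡ-injective; join-splitAt; inject₁-injective; toℕ-inject₁; toℕ<n)
  open import Data.Product using (∃; _×_; _,_; proj₁; proj₂)
  open import Data.Sum using (_⊎_; inj₁; inj₂)
  open import Data.Empty using (⊥-elim)
  open import Relation.Nullary using (yes; no)
  open import Relation.Nullary.Decidable using (¬?)
  open import Relation.Binary.PropositionalEquality using (_≡_; _≢_; refl; cong; subst; trans)
  import Relation.Binary.PropositionalEquality as ≡
  open Basics
  open Edges G connected

  n : ℕ
  n = suc n′

  position-nonroot : ∀ (p : Fin n) → idx (ord (inject₁ p)) < n
  position-nonroot p = subst (_< n) (≡.sym (trans (idx-ord (inject₁ p)) (toℕ-inject₁ p))) (toℕ<n p)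

  edgeOf : Fin n ⊎ Fin r → Edge G
  edgeOf (inj₁ p) = treeEdge (ord (inject₁ p)) (position-nonroot p)
  edgeOf (inj₂ k) = nonTree k

  treeEdge-injective : ∀ c c′ l l′ → treeEdge c l ≡ treeEdge c′ l′ → c ≡ c′
  treeEdge-injective c c′ l l′ eq = treePair-unique c c′ l l′
    (pair-trans (treeEdge-pair c l) (subst (λ e → SamePair (lo e) (hi e) c′ (parent-of c′)) (≡.sym eq) (pair-sym (treeEdge-pair c′ l′))))

  treeEdge≢nonTree : ∀ c l k → treeEdge c l ≢ nonTree k
  treeEdge≢nonTree c l k eq = nonTree-not-tree k (c , l , subst (λ e → SamePair (lo e) (hi e) c (parent-of c)) eq (pair-sym (treeEdge-pair c l)))

  edgeOf-injective : ∀ x y → edgeOf x ≡ edgeOf y → x ≡ y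
  edgeOf-injective (inj₁ p) (inj₁ p′) eq =
    cong inj₁ (inject₁-injective (trans (≡.sym (pos-ord _)) (trans (cong pos (treeEdge-injective _ _ _ _ eq)) (pos-ord _))))
  edgeOf-injective (inj₁ p) (inj₂ k′) eq = ⊥-elim (treeEdge≢nonTree (ord (inject₁ p)) (position-nonroot p) k′ eq)
  edgeOf-injective (inj₂ k) (inj₁ p′) eq = ⊥-elim (treeEdge≢nonTree (ord (inject₁ p′)) (position-nonroot p′) k (≡.sym eq))
  edgeOf-injective (inj₂ k) (inj₂ k′) eq = cong inj₂ (nonTree-inj k k′ eq)

  edgeAt : Fin (n + r) → Edge G
  edgeAt i = edgeOf (splitAt n i)

  edgeAt-injective : ∀ i i′ → edgeAt i ≡ edgeAt i′ → i ≡ i′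
  edgeAt-injective i i′ eq = begin
    i                   ≡⟨ join-splitAt n r i ⟨
    join n r (splitAt n i)  ≡⟨ cong (join n r) (edgeOf-injective (splitAt n i) (splitAt n i′) eq) ⟩
    join n r (splitAt n i′) ≡⟨ join-splitAt n r i′ ⟩
    i′                  ∎
    where open ≡.≡-Reasoning

  module _ (j : ℕ) (A : Digraph (suc n + j)) (acyclic : Acyclic A) (competition : IsCompetitionGraphOf G j A) where

    open WithIsolated G j using (addIsolated-old)
    open MinimalElement A acyclic

    old : V → Fin (suc n + j)
    old u = u ↑ˡ j

    old-≢ : ∀ {u u′} → u ≢ u′ → old u ≢ old u′
    old-≢ u≢u′ eq = u≢u′ (↑ˡ-injective j _ _ eq)

    common-sink : ∀ u u′ → adj G u u′ ≡ true → ∃ λ v → A (old u) v ≡ true × A (old u′) v ≡ true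
    common-sink u u′ uu′ = proj₂ (competition (old u) (old u′) (old-≢ (adjacent⇒≢ uu′))) (trans (addIsolated-old u u′) uu′)

    common⇒adjacent : ∀ u u′ v → u ≢ u′ → A (old u) v ≡ true → A (old u′) v ≡ true → adj G u u′ ≡ true
    common⇒adjacent u u′ v u≢u′ uv u′v =
      trans (≡.sym (addIsolated-old u u′)) (proj₁ (competition (old u) (old u′) (old-≢ u≢u′)) (v , uv , u′v))

    sink : Edge G → Fin (suc n + j)
    sink e = proj₁ (common-sink (lo e) (hi e) (proj₂ (proj₂ e)))

    lo→sink : ∀ e → A (old (lo e)) (sink e) ≡ true
    lo→sink e = proj₁ (proj₂ (common-sink (lo e) (hi e) (proj₂ (proj₂ e))))

    hi→sink : ∀ e → A (old (hi e)) (sink e) ≡ true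
    hi→sink e = proj₂ (proj₂ (common-sink (lo e) (hi e) (proj₂ (proj₂ e))))

    -- a third in-neighbour of sink e would close a triangle with e
    sink-in-neighbours : ∀ e u → A (old u) (sink e) ≡ true → u ≡ lo e ⊎ u ≡ hi e
    sink-in-neighbours e u u→sink with u ≟ lo e | u ≟ hi e
    ... | yes u≡lo | _        = inj₁ u≡lo
    ... | no  _    | yes u≡hi = inj₂ u≡hi
    ... | no  u≢lo | no  u≢hi = ⊥-elim (triangle-free (lo e) (hi e) u (proj₂ (proj₂ e))
            (common⇒adjacent (hi e) u (sink e) (λ eq → u≢hi (≡.sym eq)) (hi→sink e) u→sink)
            (common⇒adjacent (lo e) u (sink e) (λ eq → u≢lo (≡.sym eq)) (lo→sink e) u→sink))

    sink-injective : ∀ e e′ → sink e ≡ sink e′ → e ≡ e′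
    sink-injective e e′ eq = edge-unique e e′ (both (sink-in-neighbours e (lo e′) lo′→sink) (sink-in-neighbours e (hi e′) hi′→sink))
      where
      lo′→sink : A (old (lo e′)) (sink e) ≡ true
      lo′→sink = subst (λ v → A (old (lo e′)) v ≡ true) (≡.sym eq) (lo→sink e′)
      hi′→sink : A (old (hi e′)) (sink e) ≡ true
      hi′→sink = subst (λ v → A (old (hi e′)) v ≡ true) (≡.sym eq) (hi→sink e′)
      lo≢hi : lo e′ ≢ hi e′
      lo≢hi = adjacent⇒≢ (proj₂ (proj₂ e′))
      both : lo e′ ≡ lo e ⊎ lo e′ ≡ hi e → hi e′ ≡ lo e ⊎ hi e′ ≡ hi e → SamePair (lo e) (hi e) (lo e′) (hi e′)
      both (inj₁ refl) (inj₁ refl) = ⊥-elim (lo≢hi refl)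
      both (inj₁ refl) (inj₂ refl) = inj₁ (refl , refl)
      both (inj₂ refl) (inj₁ refl) = inj₂ (refl , refl)
      both (inj₂ refl) (inj₂ refl) = ⊥-elim (lo≢hi refl)

    source : Minimal (λ _ → ⊤)
    source = minimal (λ _ → ⊤) (λ _ → yes tt) zero tt

    s : Fin (suc n + j)
    s = proj₁ source

    other : Fin (suc n + j)
    other with s
    ... | zero  = suc zero
    ... | suc _ = zero

    other≢s : other ≢ s
    other≢s with s
    ... | zero  = λ ()
    ... | suc _ = λ ()

    second : Minimal (λ z → z ≢ s)
    second = minimal (λ z → z ≢ s) (λ z → ¬? (z ≟ s)) other other≢s

    b : Fin (suc n + j)
    b = proj₁ second

    s≢b : s ≢ b
    s≢b eq = proj₁ (proj₂ second) (≡.sym eq)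

    s≢sink : ∀ e → s ≢ sink e
    s≢sink e eq = true≢false (trans (≡.sym (lo→sink e)) (subst (λ v → A (old (lo e)) v ≡ false) eq (proj₂ (proj₂ source) _ tt)))

    -- one endpoint of e is not s, and it has an arc to sink e but not to b
    b≢sink : ∀ e → b ≢ sink e
    b≢sink e eq with old (lo e) ≟ s
    ... | no lo≢s  = true≢false (trans (≡.sym (lo→sink e))
                       (subst (λ v → A (old (lo e)) v ≡ false) eq (proj₂ (proj₂ second) _ lo≢s)))
    ... | yes lo≡s = true≢false (trans (≡.sym (hi→sink e))
                       (subst (λ v → A (old (hi e)) v ≡ false) eq (proj₂ (proj₂ second) _ hi≢s)))
      where
      hi≢s : old (hi e) ≢ s
      hi≢s hi≡s = old-≢ (adjacent⇒≢ (proj₂ (proj₂ e))) (trans lo≡s (≡.sym hi≡s))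

    lowerBound : suc r ≤ j
    lowerBound = +-cancelˡ-≤ n′ (suc r) j (subst (_≤ n′ + j) (≡.sym (+-suc n′ r))
      (Counting.injection-avoiding-two (λ i → sink (edgeAt i))
        (λ i i′ eq → edgeAt-injective i i′ (sink-injective _ _ eq)) s≢b (λ i → s≢sink (edgeAt i)) (λ i → b≢sink (edgeAt i))))

mainTheorem1 : ∀ (n : ℕ) (G : Graph n) → 2 ≤ n → Connected G → TriangleFree G →
    (Σ ℕ λ d → HoleSpaceDim G d × IsCompetitionNumber G (suc d)) ×
    (∀ d → HoleSpaceDim G d → IsCompetitionNumber G (suc d))
mainTheorem1 (suc zero) G (s≤s ()) _ _
mainTheorem1 (suc (suc n′)) G _ connected triangle-free =
  (r , dim , competitionNumber) ,
  λ d dim′ → subst (λ d → IsCompetitionNumber G (suc d)) (EdgeSpace.HoleSpaceDim-unique G dim dim′) competitionNumber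
  where
  open Edges G connected using (r)

  dim : HoleSpaceDim G r
  dim = FundamentalCycles.holeSpaceDim G connected triangle-free

  competitionNumber : IsCompetitionNumber G (suc r)
  competitionNumber = UpperBound.upperBound G connected ,
    λ { j j<r+1 (A , acyclic , competition) → <⇒≱ j<r+1 (LowerBound.lowerBound G connected triangle-free j A acyclic competition) }
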